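{- Let $G$ be a forest containing no isolated edges. Then $\chi'_t(G)\leq\Delta(G)+2$ if $\Delta(G)$ is odd, and $\chi'_t(G)\leq\Delta(G)+3$ otherwise.
   Context: An isolated edge is a connected component isomorphic to $K_2$. A twin edge $k$-coloring of a graph $G$ is a proper edge labeling $f:E(G)\to\mathbb{Z}_k$ (adjacent edges receive distinct labels) such that the induced vertex coloring $w(v)=\sum_{u\in N(v)}f(uv)\pmod k$ satisfies $w(u)\neq w(v)$ for every edge $uv$. The twin chromatic index $\chi'_t(G)$ is the least integer $k\geq 2$ for which $G$ has a twin edge $k$-coloring. $\Delta(G)$ is the maximum degree. -}

module Defs where

open import Data.Nat using (ℕ; zero; suc; _+_; _≤_; _⊔_; _%_; NonZero)
open import Data.Nat.Properties using (≤-trans)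
open import Data.Fin using (Fin; zero; suc; toℕ; inject₁; fromℕ)
open import Data.Bool using (Bool; true; false; if_then_else_)
open import Data.Product using (Σ; _×_; _,_; ∃)
open import Relation.Binary.PropositionalEquality using (_≡_; _≢_)
open import Relation.Nullary using (¬_)
open import Function.Definitions using (Injective)

ΣFin : ∀ {n} → (Fin n → ℕ) → ℕ
ΣFin {zero}  f = 0
ΣFin {suc n} f = f zero + ΣFin (λ i → f (suc i))

maxFin : ∀ {n} → (Fin n → ℕ) → ℕ
maxFin {zero}  f = 0
maxFin {suc n} f = f zero ⊔ maxFin (λ i → f (suc i))

record Graph (n : ℕ) : Set where
  field
    adj     : Fin n → Fin n → Bool
    sym     : ∀ u v → adj u v ≡ adj v u
    irrefl  : ∀ v → adj v v ≡ false
open Graph public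

Adj : ∀ {n} → Graph n → Fin n → Fin n → Set
Adj G u v = adj G u v ≡ true

deg : ∀ {n} → Graph n → Fin n → ℕ
deg G v = ΣFin (λ u → if adj G v u then 1 else 0)

Δ : ∀ {n} → Graph n → ℕ
Δ G = maxFin (deg G)

-- A cycle of length m+1 ≥ 3: distinct vertices c 0, …, c m with
-- consecutive ones adjacent and c m adjacent to c 0.
record Cycle {n} (G : Graph n) : Set where
  field
    m      : ℕ
    len≥3  : 2 ≤ m
    c      : Fin (suc m) → Fin n
    inj    : Injective _≡_ _≡_ c
    step   : ∀ (i : Fin m) → Adj G (c (inject₁ i)) (c (suc i))
    close  : Adj G (c (fromℕ m)) (c zero)

Forest : ∀ {n} → Graph n → Set
Forest G = ¬ Cycle G

-- The edge uv forms a connected component isomorphic to K₂: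
-- v is the only neighbour of u and u is the only neighbour of v.
IsolatedEdge : ∀ {n} → Graph n → Fin n → Fin n → Set
IsolatedEdge G u v =
  Adj G u v × (∀ w → Adj G u w → w ≡ v) × (∀ w → Adj G v w → w ≡ u)

NoIsolatedEdges : ∀ {n} → Graph n → Set
NoIsolatedEdges G = ∀ u v → ¬ IsolatedEdge G u v

-- Edge labelling with labels in ℤ_k = Fin k; f u v is the label of edge uv
-- (values on non-edges are irrelevant).
EdgeLabelling : ℕ → ℕ → Set
EdgeLabelling n k = Fin n → Fin n → Fin k

weight : ∀ {n k} .{{_ : NonZero k}} → Graph n → EdgeLabelling n k → Fin n → ℕ
weight {k = k} G f v = ΣFin (λ u → if adj G v u then toℕ (f v u) else 0) % k

record TwinEdgeColouring {n} (G : Graph n) (k : ℕ) .{{_ : NonZero k}} : Set where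
  field
    f        : EdgeLabelling n k
    symm     : ∀ u v → Adj G u v → f u v ≡ f v u
    proper   : ∀ u v w → Adj G u v → Adj G u w → v ≢ w → f u v ≢ f u w
    twin     : ∀ u v → Adj G u v → weight G f u ≢ weight G f v

-- χ'_t(G) ≤ B : the least k ≥ 2 admitting a twin edge k-colouring is ≤ B,
-- i.e. some k with 2 ≤ k ≤ B admits one.  (k is written suc k' so that
-- the NonZero instance for the modulus is available.)
χ't≤ : ∀ {n} → Graph n → ℕ → Set
χ't≤ G B = Σ ℕ λ k' → 2 ≤ suc k' × suc k' ≤ B × TwinEdgeColouring G (suc k')

{-# OPTIONS --safe #-}
module Submission where

-- Let H = ⌊Δ/2⌋ + 1 and K = 2H + 1, which is Δ + 2 for odd Δ and Δ + 3 for even Δ;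
-- every degree is at most D = 2H − 1.  A twin edge K-colouring is built by induction
-- on the degree sum.  A longest path in the forest ends in a pendant star: a vertex v
-- carrying a leaf, all of whose neighbours but at most one, x, are leaves.  Delete the
-- edges from v to its leaves (and from x to its leaves too when v and x span a double
-- star with both degrees D), colour the smaller forest, and label the deleted edges.
-- The labels come from the residues mod K: the nonzero ones fall into the H classes
-- {e, K − e}, whole classes add 0 to a weight, so only a core of two or three labels has
-- to be chosen to keep the new weight of v away from the weights of its neighbours.
-- The induction carries one invariant: an edge to a leaf is labelled 0 only at the
-- centre of a full star (degree D, all neighbours leaves).  It makes the label of the
-- edge vx nonzero in the pendant case, where v has become a leaf of the smaller forest.

open import Defs hiding (sym)
open import Data.Nat
open import Data.Nat.Properties
open import Data.Nat.DivMod
  using (_mod_; m<n⇒m%n≡m; [m+kn]%n≡m%n; [m+n]%n≡m%n; m%n<n; %-distribˡ-+; m%n%n≡m%n; m≡m%n+[m/n]*n)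
open import Data.Nat.Solver using (module +-*-Solver)
open import Data.Fin using (Fin; zero; suc; toℕ; inject₁; fromℕ; inject≤; punchIn; punchOut; fromℕ<) renaming (_<_ to _<ᶠ_)
open import Data.Fin.Properties
  using (any?; all?; pigeonhole; injective⇒≤; toℕ-fromℕ<; toℕ-injective; toℕ-inject≤; toℕ<n;
         punchInᵢ≢i; punchIn-injective; punchIn-punchOut)
  renaming (_≟_ to _≟F_; suc-injective to fsuc-inj; <-irrefl to <ᶠ-irrefl)
open import Data.Bool using (Bool; true; false; if_then_else_; _∧_; _∨_; not)
open import Data.Bool.Properties using (∨-comm; ∧-conicalˡ; ∧-conicalʳ) renaming (_≟_ to _≟B_)
open import Data.List using (List; []; _∷_; _++_; length; lookup; [_])
open import Data.List.Relation.Unary.All using (All; []; _∷_)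
import Data.List.Relation.Unary.All as All
import Data.List.Relation.Unary.All.Properties as All
open import Data.List.Relation.Unary.All.Properties using (¬Any⇒All¬)
open import Data.List.Relation.Unary.Any using (here; there)
open import Data.List.Membership.Propositional using (_∈_; _∉_)
open import Data.List.Membership.Propositional.Properties using (∈-∃++; ∈-lookup)
open import Data.List.Properties using (length-++)
open import Data.Nat.ListAction using (sum)
open import Data.Nat.ListAction.Properties using (sum-++)
open import Data.List.Relation.Unary.Linked using (Linked; []; [-]; _∷_)
import Data.List.Relation.Unary.Linked as Linked
open import Data.List.Relation.Unary.AllPairs using (AllPairs; []; _∷_)
import Data.List.Relation.Unary.AllPairs as AllPairs
import Data.List.Relation.Unary.AllPairs.Properties as AllPairs
open import Data.List.Relation.Unary.Unique.Propositional using (Unique)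
open import Data.Product using (Σ; _×_; _,_; ∃; proj₁; proj₂)
open import Data.Sum using (_⊎_; inj₁; inj₂)
open import Data.Empty using (⊥; ⊥-elim)
open import Relation.Nullary using (¬_; Dec; yes; no; contradiction)
open import Relation.Nullary.Decidable using (_×-dec_; ¬?; _→-dec_)
open import Relation.Binary.PropositionalEquality hiding ([_])
open +-*-Solver
open import Function.Base using (_∘_)
open import Algebra.Properties.CommutativeSemigroup +-commutativeSemigroup using () renaming (interchange to +-interchange)

ind : Bool → ℕ
ind b = if b then 1 else 0

ΣFin-cong : ∀ {n} {f g : Fin n → ℕ} → (∀ i → f i ≡ g i) → ΣFin f ≡ ΣFin g
ΣFin-cong {zero} e = refl
ΣFin-cong {suc n} e = cong₂ _+_ (e zero) (ΣFin-cong (λ i → e (suc i)))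

ΣFin-+ : ∀ {n} (f g : Fin n → ℕ) → ΣFin (λ i → f i + g i) ≡ ΣFin f + ΣFin g
ΣFin-+ {zero} f g = refl
ΣFin-+ {suc n} f g = trans (cong (f zero + g zero +_) (ΣFin-+ (λ i → f (suc i)) (λ i → g (suc i))))
                           (+-interchange (f zero) (g zero) _ _)

ΣFin-zero : ∀ {n} (f : Fin n → ℕ) → (∀ i → f i ≡ 0) → ΣFin f ≡ 0
ΣFin-zero {zero} f e = refl
ΣFin-zero {suc n} f e rewrite e zero = ΣFin-zero (λ i → f (suc i)) (λ i → e (suc i))

ΣFin-mono : ∀ {n} (f g : Fin n → ℕ) → (∀ i → f i ≤ g i) → ΣFin f ≤ ΣFin g
ΣFin-mono {zero} f g e = z≤n
ΣFin-mono {suc n} f g e = +-mono-≤ (e zero) (ΣFin-mono _ _ (λ i → e (suc i)))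

ΣFin-strict : ∀ {n} (f g : Fin n → ℕ) → (∀ i → f i ≤ g i) → ∀ x → f x < g x → ΣFin f < ΣFin g
ΣFin-strict f g le zero lt = +-mono-<-≤ lt (ΣFin-mono _ _ (λ i → le (suc i)))
ΣFin-strict f g le (suc x) lt = +-mono-≤-< (le zero) (ΣFin-strict _ _ (λ i → le (suc i)) x lt)

ΣFin-single : ∀ {n} (f : Fin n → ℕ) (x : Fin n) → (∀ i → i ≢ x → f i ≡ 0) → ΣFin f ≡ f x
ΣFin-single {suc n} f zero e =
  trans (cong (f zero +_) (ΣFin-zero _ (λ i → e (suc i) (λ ())))) (+-identityʳ _)
ΣFin-single {suc n} f (suc x) e rewrite e zero (λ ()) =
  ΣFin-single (λ i → f (suc i)) x (λ i ne → e (suc i) (λ q → ne (fsuc-inj q)))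

f≤ΣFin : ∀ {n} (f : Fin n → ℕ) (x : Fin n) → f x ≤ ΣFin f
f≤ΣFin f zero = m≤m+n _ _
f≤ΣFin f (suc x) = ≤-trans (f≤ΣFin (λ i → f (suc i)) x) (m≤n+m _ (f zero))

f+f≤ΣFin : ∀ {n} (f : Fin n → ℕ) (x y : Fin n) → x ≢ y → f x + f y ≤ ΣFin f
f+f≤ΣFin f zero zero x≢y = ⊥-elim (x≢y refl)
f+f≤ΣFin f zero (suc y) _ = +-monoʳ-≤ (f zero) (f≤ΣFin (λ i → f (suc i)) y)
f+f≤ΣFin f (suc x) zero _ =
  subst (_≤ ΣFin f) (+-comm (f zero) _) (+-monoʳ-≤ (f zero) (f≤ΣFin (λ i → f (suc i)) x))
f+f≤ΣFin f (suc x) (suc y) x≢y =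
  ≤-trans (f+f≤ΣFin (λ i → f (suc i)) x y (λ e → x≢y (cong suc e))) (m≤n+m _ (f zero))

point : ∀ {n} → Fin n → ℕ → Fin n → ℕ
point x a i with i ≟F x
... | yes _ = a
... | no _ = 0

ΣFin-point : ∀ {n} (x : Fin n) a → ΣFin (point x a) ≡ a
ΣFin-point x a = trans (ΣFin-single (point x a) x off-x) at-x
  where
  off-x : ∀ i → i ≢ x → point x a i ≡ 0
  off-x i i≢x with i ≟F x
  ... | yes i≡x = ⊥-elim (i≢x i≡x)
  ... | no _ = refl
  at-x : point x a x ≡ a
  at-x with x ≟F x
  ... | yes _ = refl
  ... | no x≢x = ⊥-elim (x≢x refl)

deg≤Δ : ∀ {n} (G : Graph n) u → deg G u ≤ Δ G
deg≤Δ G = maxFin-≥ (deg G)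
  where
  maxFin-≥ : ∀ {n} (f : Fin n → ℕ) x → f x ≤ maxFin f
  maxFin-≥ f zero = m≤m⊔n _ _
  maxFin-≥ f (suc x) = ≤-trans (maxFin-≥ (λ i → f (suc i)) x) (m≤n⊔m (f zero) _)

count : ∀ {n} → (Fin n → Bool) → ℕ
count L = ΣFin (λ i → ind (L i))

-- rank L numbers the indices selected by L as 0, 1, …, count L − 1.
rank : ∀ {n} → (Fin n → Bool) → Fin n → ℕ
rank L zero = 0
rank L (suc i) = ind (L zero) + rank (λ j → L (suc j)) i

sumTo : (ℕ → ℕ) → ℕ → ℕ
sumTo φ zero = 0
sumTo φ (suc k) = φ 0 + sumTo (λ i → φ (suc i)) k

rank-sum : ∀ {n} (L : Fin n → Bool) (φ : ℕ → ℕ) →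
  ΣFin (λ u → if L u then φ (rank L u) else 0) ≡ sumTo φ (count L)
rank-sum {zero} L φ = refl
rank-sum {suc n} L φ with L zero
... | true = cong (φ 0 +_) (rank-sum (λ j → L (suc j)) (λ i → φ (suc i)))
... | false = rank-sum (λ j → L (suc j)) φ

rank-< : ∀ {n} (L : Fin n → Bool) u → L u ≡ true → rank L u < count L
rank-< L zero e rewrite e = s≤s z≤n
rank-< L (suc u) e with L zero
... | true = s≤s (rank-< (λ j → L (suc j)) u e)
... | false = rank-< (λ j → L (suc j)) u e

rank-injective : ∀ {n} (L : Fin n → Bool) u w → L u ≡ true → L w ≡ true →
                 rank L u ≡ rank L w → u ≡ w
rank-injective L zero zero _ _ _ = refl
rank-injective L zero (suc w) e1 e2 r rewrite e1 with r
... | ()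
rank-injective L (suc u) zero e1 e2 r rewrite e2 with r
... | ()
rank-injective L (suc u) (suc w) e1 e2 r =
  cong suc (rank-injective (λ j → L (suc j)) u w e1 e2 (+-cancelˡ-≡ (ind (L zero)) _ _ r))

-- Out of range, nth returns 0.
nth : List ℕ → ℕ → ℕ
nth [] i = 0
nth (x ∷ xs) zero = x
nth (x ∷ xs) (suc i) = nth xs i

sumTo-nth : ∀ xs → sumTo (nth xs) (length xs) ≡ sum xs
sumTo-nth [] = refl
sumTo-nth (x ∷ xs) = cong (x +_) (sumTo-nth xs)

All-nth : ∀ {P : ℕ → Set} {xs} → All P xs → ∀ i → i < length xs → P (nth xs i)
All-nth (p ∷ _) zero _ = p
All-nth (_ ∷ ps) (suc i) (s≤s lt) = All-nth ps i lt

nth-injective : ∀ {xs} → Unique xs → ∀ i j → i < length xs → j < length xs → nth xs i ≡ nth xs j → i ≡ j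
nth-injective (a ∷ d) zero zero _ _ _ = refl
nth-injective (a ∷ d) zero (suc j) _ (s≤s lj) e = ⊥-elim (All-nth a j lj e)
nth-injective (a ∷ d) (suc i) zero (s≤s li) _ e = ⊥-elim (All-nth a i li (sym e))
nth-injective (a ∷ d) (suc i) (suc j) (s≤s li) (s≤s lj) e = cong suc (nth-injective d i j li lj e)

All-nth₀ : ∀ {P : ℕ → Set} {xs} → P 0 → All P xs → ∀ i → P (nth xs i)
All-nth₀ p0 [] i = p0
All-nth₀ p0 (p ∷ _) zero = p
All-nth₀ p0 (_ ∷ ps) (suc i) = All-nth₀ p0 ps i

remove : ∀ {H} (e : Fin (suc H)) → List (Fin (suc H)) → List (Fin H)
remove e [] = []
remove e (x ∷ xs) with e ≟F x
... | yes _ = remove e xs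
... | no ne = punchOut ne ∷ remove e xs

length-remove≤ : ∀ {H} (e : Fin (suc H)) xs → length (remove e xs) ≤ length xs
length-remove≤ e [] = z≤n
length-remove≤ e (x ∷ xs) with e ≟F x
... | yes _ = m≤n⇒m≤1+n (length-remove≤ e xs)
... | no _ = s≤s (length-remove≤ e xs)

remove-All≢ : ∀ {H} (e : Fin (suc H)) (y : Fin H) xs → All (y ≢_) (remove e xs) → All (punchIn e y ≢_) xs
remove-All≢ e y [] _ = []
remove-All≢ e y (x ∷ xs) h with e ≟F x
... | yes refl = punchInᵢ≢i e y ∷ remove-All≢ e y xs h
remove-All≢ e y (x ∷ xs) (h ∷ hs) | no ne =
  (λ q → h (punchIn-injective e y _ (trans q (sym (punchIn-punchOut ne))))) ∷ remove-All≢ e y xs hs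

distinct-avoiding : ∀ H m (F : List (Fin H)) → length F + m ≤ H →
  Σ (Fin m → Fin H) λ E → (∀ i j → E i ≡ E j → i ≡ j) × (∀ i → All (E i ≢_) F)
distinct-avoiding H m [] le = (λ i → inject≤ i le) ,
  (λ i j e → toℕ-injective (trans (sym (toℕ-inject≤ i le)) (trans (cong toℕ e) (toℕ-inject≤ j le)))) ,
  (λ i → [])
distinct-avoiding zero m (e ∷ F) ()
distinct-avoiding (suc H) m (e ∷ F) (s≤s le)
  with distinct-avoiding H m (remove e F) (≤-trans (+-monoˡ-≤ m (length-remove≤ e F)) le)
... | E , inj , av = (λ i → punchIn e (E i)) ,
  (λ i j q → inj i j (punchIn-injective e _ _ q)) ,
  (λ i → punchInᵢ≢i e (E i) ∷ remove-All≢ e (E i) F (av i))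

insertAt : ℕ → ℕ → List ℕ → List ℕ
insertAt zero y xs = y ∷ xs
insertAt (suc r) y [] = y ∷ []
insertAt (suc r) y (x ∷ xs) = x ∷ insertAt r y xs

length-insertAt : ∀ r y xs → length (insertAt r y xs) ≡ suc (length xs)
length-insertAt zero y xs = refl
length-insertAt (suc r) y [] = refl
length-insertAt (suc r) y (x ∷ xs) = cong suc (length-insertAt r y xs)

sum-insertAt : ∀ r y xs → sum (insertAt r y xs) ≡ y + sum xs
sum-insertAt zero y xs = refl
sum-insertAt (suc r) y [] = refl
sum-insertAt (suc r) y (x ∷ xs) = trans (cong (x +_) (sum-insertAt r y xs))
  (trans (sym (+-assoc x y _)) (trans (cong (_+ sum xs) (+-comm x y)) (+-assoc y x _)))

nth-insertAt : ∀ r y xs → r ≤ length xs → nth (insertAt r y xs) r ≡ y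
nth-insertAt zero y xs _ = refl
nth-insertAt (suc r) y (x ∷ xs) (s≤s le) = nth-insertAt r y xs le

All-insertAt : ∀ {P : ℕ → Set} r y xs → P y → All P xs → All P (insertAt r y xs)
All-insertAt zero y xs py a = py ∷ a
All-insertAt (suc r) y [] py a = py ∷ []
All-insertAt (suc r) y (x ∷ xs) py (px ∷ a) = px ∷ All-insertAt r y xs py a

Unique-insertAt : ∀ r y xs → All (y ≢_) xs → Unique xs → Unique (insertAt r y xs)
Unique-insertAt zero y xs a d = a ∷ d
Unique-insertAt (suc r) y [] a d = [] ∷ []
Unique-insertAt (suc r) y (x ∷ xs) (yx ∷ a) (ax ∷ d) =
  All-insertAt r y xs (≢-sym yx) ax ∷ Unique-insertAt r y xs a d

nth-insertAt-other : ∀ {P : ℕ → Set} r y xs → r ≤ length xs → All P xs →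
                     ∀ i → i ≢ r → i < suc (length xs) → P (nth (insertAt r y xs) i)
nth-insertAt-other zero y xs _ a zero ne lt = ⊥-elim (ne refl)
nth-insertAt-other zero y xs _ a (suc i) ne (s≤s lt) = All-nth a i lt
nth-insertAt-other (suc r) y [] () a i ne lt
nth-insertAt-other (suc r) y (x ∷ xs) _ (px ∷ a) zero ne lt = px
nth-insertAt-other (suc r) y (x ∷ xs) (s≤s le) (px ∷ a) (suc i) ne (s≤s lt) =
  nth-insertAt-other r y xs le a i (λ q → ne (cong suc q)) lt

m+m≢1+n+n : ∀ m n → m + m ≢ suc (n + n)
m+m≢1+n+n m n e =
  even≢odd m n (trans (cong (m +_) (+-identityʳ m)) (trans e (cong (λ k → suc (n + k)) (sym (+-identityʳ n)))))

unobstructed-candidate : ∀ {n m} → m < n → (P : ℕ → Set) → (∀ y → Dec (P y)) →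
  (cand : Fin n → ℕ) → (Tag : Fin m → ℕ → Set) →
  (∀ i → ¬ P (cand i) → Σ (Fin m) λ t → Tag t (cand i)) →
  (∀ t i j → i <ᶠ j → Tag t (cand i) → Tag t (cand j) → ⊥) →
  Σ (Fin n) λ i → P (cand i)
unobstructed-candidate {n} {m} lt P P? cand Tag tagOf uniq with any? (λ i → P? (cand i))
... | yes r = r
... | no nr with pigeonhole lt (λ i → proj₁ (tagOf i (λ p → nr (i , p))))
... | i , j , i<j , e =
  ⊥-elim (uniq _ i j i<j (proj₂ (tagOf i (λ p → nr (i , p))))
     (subst (λ t → Tag t (cand j)) (sym e) (proj₂ (tagOf j (λ p → nr (j , p))))))

module _ {n : ℕ} (G : Graph n) where

  Leaf : Fin n → Set
  Leaf u = deg G u ≡ 1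

  leaf? : ∀ u → Dec (Leaf u)
  leaf? u = deg G u ≟ 1

  adj? : ∀ u v → Dec (Adj G u v)
  adj? u v = adj G u v ≟B true

  Adj-sym : ∀ {u v} → Adj G u v → Adj G v u
  Adj-sym {u} {v} a = trans (Graph.sym G v u) a

  Adj-irrefl : ∀ {v} → ¬ Adj G v v
  Adj-irrefl {v} a with trans (sym a) (Graph.irrefl G v)
  ... | ()

  ind-nonadj : ∀ u v → ¬ Adj G u v → ind (adj G u v) ≡ 0
  ind-nonadj u v ¬uv with adj G u v
  ... | true = ⊥-elim (¬uv refl)
  ... | false = refl

  ind-adj : ∀ u v → Adj G u v → ind (adj G u v) ≡ 1
  ind-adj u v uv rewrite uv = refl

  leaf-nbr-unique : ∀ {u y z} → Leaf u → Adj G u y → Adj G u z → y ≡ z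
  leaf-nbr-unique {u} {y} {z} l uy uz with y ≟F z
  ... | yes y≡z = y≡z
  ... | no y≢z = ⊥-elim (<⇒≱ (s≤s (s≤s z≤n)) (subst (2 ≤_) l
          (subst (_≤ deg G u) (cong₂ _+_ (ind-adj u y uy) (ind-adj u z uz))
             (f+f≤ΣFin (λ w → ind (adj G u w)) y z y≢z))))

  unique-nbr⇒Leaf : ∀ {u y} → Adj G u y → (∀ z → Adj G u z → z ≡ y) → Leaf u
  unique-nbr⇒Leaf {u} {y} uy unique = trans (ΣFin-single _ y off-y) (ind-adj u y uy)
    where
    off-y : ∀ i → i ≢ y → ind (adj G u i) ≡ 0
    off-y i i≢y = ind-nonadj u i (λ ui → i≢y (unique i ui))

  ¬Leaf⇒other-nbr : ∀ {u y} → ¬ Leaf u → Adj G u y → ∃ λ z → Adj G u z × z ≢ y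
  ¬Leaf⇒other-nbr {u} {y} ¬leaf uy with any? (λ z → adj? u z ×-dec ¬? (z ≟F y))
  ... | yes found = found
  ... | no none = ⊥-elim (¬leaf (unique-nbr⇒Leaf uy only-y))
    where
    only-y : ∀ z → Adj G u z → z ≡ y
    only-y z uz with z ≟F y
    ... | yes z≡y = z≡y
    ... | no z≢y = ⊥-elim (none (z , uz , z≢y))

module _ {A : Set} where

  lastOf : A → List A → A
  lastOf a [] = a
  lastOf a (b ∷ r) = lastOf b r

  lastOf-∷ʳ : ∀ a xs y → lastOf a (xs ++ [ y ]) ≡ y
  lastOf-∷ʳ a [] y = refl
  lastOf-∷ʳ a (b ∷ xs) y = lastOf-∷ʳ b xs y

  lookup-last : ∀ x xs → lookup (x ∷ xs) (fromℕ (length xs)) ≡ lastOf x xs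
  lookup-last x [] = refl
  lookup-last x (y ∷ r) = lookup-last y r

  lookup-injective : ∀ {xs : List A} → Unique xs → ∀ {i j} → lookup xs i ≡ lookup xs j → i ≡ j
  lookup-injective (_ ∷ _) {zero} {zero} _ = refl
  lookup-injective (x∉ ∷ _) {zero} {suc j} e = ⊥-elim (All.lookup x∉ (∈-lookup j) e)
  lookup-injective (x∉ ∷ _) {suc i} {zero} e = ⊥-elim (All.lookup x∉ (∈-lookup i) (sym e))
  lookup-injective (_ ∷ u) {suc i} {suc j} e = cong suc (lookup-injective u e)

  lookup-Linked : ∀ {R : A → A → Set} x xs → Linked R (x ∷ xs) → (i : Fin (length xs)) →
                  R (lookup (x ∷ xs) (inject₁ i)) (lookup xs i)
  lookup-Linked x (y ∷ r) (xy ∷ _) zero = xy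
  lookup-Linked x (y ∷ r) (_ ∷ l) (suc i) = lookup-Linked y r l i

  Linked-prefix : ∀ {R : A → A → Set} (as : List A) y bs → Linked R (as ++ y ∷ bs) → Linked R (as ++ [ y ])
  Linked-prefix [] y bs _ = [-]
  Linked-prefix (a ∷ []) y bs (ay ∷ _) = ay ∷ [-]
  Linked-prefix (a ∷ b ∷ as) y bs (ab ∷ l) = ab ∷ Linked-prefix (b ∷ as) y bs l

  All-prefix : ∀ {P : A → Set} (as : List A) y bs → All P (as ++ y ∷ bs) → All P (as ++ [ y ])
  All-prefix [] y bs (py ∷ _) = py ∷ []
  All-prefix (a ∷ as) y bs (pa ∷ ps) = pa ∷ All-prefix as y bs ps

  Unique-prefix : ∀ (as : List A) y bs → Unique (as ++ y ∷ bs) → Unique (as ++ [ y ])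
  Unique-prefix [] y bs _ = [] ∷ []
  Unique-prefix (a ∷ as) y bs (a∉ ∷ u) = All-prefix as y bs a∉ ∷ Unique-prefix as y bs u

Unique-length≤ : ∀ {n} {xs : List (Fin n)} → Unique xs → length xs ≤ n
Unique-length≤ u = injective⇒≤ (lookup-injective u)

module _ {n : ℕ} (G : Graph n) where

  closed-path⇒Cycle : ∀ x xs → Linked (Adj G) (x ∷ xs) → Unique (x ∷ xs) → 2 ≤ length xs →
                      Adj G (lastOf x xs) x → Cycle G
  closed-path⇒Cycle x xs l u 2≤ closing = record
    { m = length xs ; len≥3 = 2≤ ; c = lookup (x ∷ xs) ; inj = lookup-injective u
    ; step = lookup-Linked x xs l ; close = subst (λ z → Adj G z x) (sym (lookup-last x xs)) closing }

  -- A neighbour of the end a of a path a b r … lying further along would close a cycle.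
  no-chord : Forest G → ∀ {a b r y} → Linked (Adj G) (a ∷ b ∷ r) → Unique (a ∷ b ∷ r) →
             Adj G a y → y ∉ r
  no-chord forest {a} {b} {r} {y} l u ay y∈r with ∈-∃++ y∈r
  ... | as , bs , refl =
    forest (closed-path⇒Cycle a (b ∷ as ++ [ y ]) (Linked-prefix (a ∷ b ∷ as) y bs l)
             (Unique-prefix (a ∷ b ∷ as) y bs u) (s≤s (subst (1 ≤_) (sym (length-++ as)) (m≤n+m 1 (length as))))
             (subst (λ z → Adj G z a) (sym (lastOf-∷ʳ b as y)) (Adj-sym G ay)))

  record PendantStar : Set where
    constructor pendant-star
    field
      v x c : Fin n
      vc : Adj G v c
      c-leaf : Leaf G c
      leaves : ∀ y → Adj G v y → y ≢ x → Leaf G y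

  open import Data.List.Membership.DecPropositional (_≟F_ {n}) using (_∈?_)

  ExtendsAt : Fin n → List (Fin n) → Fin n → Set
  ExtendsAt a P y = Adj G a y × y ∉ P

  extendsAt? : ∀ a P y → Dec (ExtendsAt a P y)
  extendsAt? a P y = adj? G a y ×-dec ¬? (y ∈? P)

  ExtendsTwiceAt : Fin n → List (Fin n) → Fin n → Set
  ExtendsTwiceAt b P y = ExtendsAt b P y × ∃ (ExtendsAt y (y ∷ P))

  extendsTwiceAt? : ∀ b P y → Dec (ExtendsTwiceAt b P y)
  extendsTwiceAt? b P y = extendsAt? b P y ×-dec any? (extendsAt? y (y ∷ P))

  -- The path a ∷ b ∷ r is kept reversed, a being its free end.  It is prolonged at a, or
  -- by two vertices at b; when neither is possible, a is a leaf hanging at b and every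
  -- neighbour of b off the path is a leaf, so b is the centre of a pendant star.  The
  -- fuel k bounds the number of extensions, since a path has at most n vertices.
  extend : Forest G → (k : ℕ) → ∀ a b r → Linked (Adj G) (a ∷ b ∷ r) → Unique (a ∷ b ∷ r) →
           n < length (a ∷ b ∷ r) + k → PendantStar
  extend forest zero a b r l u n< =
    ⊥-elim (<⇒≱ n< (≤-trans (≤-reflexive (+-identityʳ _)) (Unique-length≤ u)))
  extend forest (suc k) a b r l u n< with any? (extendsAt? a (a ∷ b ∷ r))
  ... | yes (y , ay , y∉) =
    extend forest k y a (b ∷ r) (Adj-sym G ay ∷ l) (¬Any⇒All¬ _ y∉ ∷ u) (subst (n <_) (+-suc _ k) n<)
  ... | no stuck-a with any? (extendsTwiceAt? b (a ∷ b ∷ r))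
  ...   | yes (y , (by , y∉) , z , yz , z∉) =
    extend forest k z y (b ∷ r) (Adj-sym G yz ∷ Adj-sym G by ∷ Linked.tail l)
      (¬Any⇒All¬ _ (λ z∈ → z∉ (skip-a z∈)) ∷ ¬Any⇒All¬ _ (λ y∈ → y∉ (there y∈)) ∷ AllPairs.tail u)
      (subst (n <_) (+-suc _ k) n<)
    where
    skip-a : ∀ {z} → z ∈ (y ∷ b ∷ r) → z ∈ (y ∷ a ∷ b ∷ r)
    skip-a (here e) = here e
    skip-a (there z∈) = there (there z∈)
  ...   | no stuck-b = record { v = b ; x = x ; c = a ; vc = Adj-sym G ab ; c-leaf = a-leaf ; leaves = leaves }
    where
    ab : Adj G a b
    ab = Linked.head l
    lb : Linked (Adj G) (b ∷ r)
    lb = Linked.tail l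
    ub : Unique (b ∷ r)
    ub = AllPairs.tail u
    a-leaf : Leaf G a
    a-leaf = unique-nbr⇒Leaf G ab only-b
      where
      only-b : ∀ y → Adj G a y → y ≡ b
      only-b y ay with y ∈? (a ∷ b ∷ r)
      ... | no y∉ = ⊥-elim (stuck-a (y , ay , y∉))
      ... | yes (here refl) = ⊥-elim (Adj-irrefl G ay)
      ... | yes (there (here refl)) = refl
      ... | yes (there (there y∈r)) = ⊥-elim (no-chord forest l u ay y∈r)
    headOr : Fin n → List (Fin n) → Fin n
    headOr a [] = a
    headOr _ (h ∷ _) = h
    x : Fin n
    x = headOr a r
    off-path : ∀ {r y} → Linked (Adj G) (b ∷ r) → Unique (b ∷ r) → Adj G b y → y ≢ headOr a r → y ∉ r
    off-path {h ∷ _} _ _ _ y≢h (here refl) = y≢h refl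
    off-path {h ∷ _} lb ub by _ (there y∈) = no-chord forest lb ub by y∈
    leaves : ∀ y → Adj G b y → y ≢ x → Leaf G y
    leaves y by y≢x with y ∈? (a ∷ b ∷ r)
    ... | yes (here refl) = a-leaf
    ... | yes (there (here refl)) = ⊥-elim (Adj-irrefl G by)
    ... | yes (there (there y∈r)) = ⊥-elim (off-path lb ub by y≢x y∈r)
    ... | no y∉ = unique-nbr⇒Leaf G (Adj-sym G by) only-b
      where
      only-b : ∀ z → Adj G y z → z ≡ b
      only-b z yz with z ≟F b
      ... | yes z≡b = z≡b
      ... | no z≢b with z ∈? (y ∷ a ∷ b ∷ r)
      ...   | no z∉ = ⊥-elim (stuck-b (y , (by , y∉) , z , yz , z∉))
      ...   | yes (here refl) = ⊥-elim (Adj-irrefl G yz)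
      ...   | yes (there (here refl)) = ⊥-elim (stuck-a (y , Adj-sym G yz , y∉))
      ...   | yes (there (there (here refl))) = ⊥-elim (z≢b refl)
      ...   | yes (there (there (there z∈r))) =
                ⊥-elim (no-chord forest (Adj-sym G by ∷ lb) (¬Any⇒All¬ _ (λ y∈ → y∉ (there y∈)) ∷ ub) yz z∈r)

  pendantStar : Forest G → ∀ {a b} → Adj G a b → PendantStar
  pendantStar forest {a} {b} ab = extend forest n a b [] (ab ∷ [-])
    (((λ a≡b → Adj-irrefl G (subst (Adj G a) (sym a≡b) ab)) ∷ []) ∷ [] ∷ [])
    (s≤s (n≤1+n n))

isLeafᵇ : ∀ {n} → Graph n → Fin n → Bool
isLeafᵇ G w = deg G w ≡ᵇ 1

isLeafᵇ⇒Leaf : ∀ {n} (G : Graph n) w → isLeafᵇ G w ≡ true → Leaf G w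
isLeafᵇ⇒Leaf G w e = ≡ᵇ⇒≡ (deg G w) 1 (subst Data.Bool.T (sym e) _)

Leaf⇒isLeafᵇ : ∀ {n} (G : Graph n) w → Leaf G w → isLeafᵇ G w ≡ true
Leaf⇒isLeafᵇ G w l rewrite l = refl

¬Leaf⇒isLeafᵇ≡false : ∀ {n} (G : Graph n) w → ¬ Leaf G w → isLeafᵇ G w ≡ false
¬Leaf⇒isLeafᵇ≡false G w ¬leaf with isLeafᵇ G w in e
... | true = ⊥-elim (¬leaf (isLeafᵇ⇒Leaf G w e))
... | false = refl

TrueOrFalse : Bool → Set
TrueOrFalse b = b ≡ true ⊎ b ≡ false

true-or-false : ∀ b → TrueOrFalse b
true-or-false true = inj₁ refl
true-or-false false = inj₂ refl

ind∧≤ : ∀ a b → ind (a ∧ b) ≤ ind a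
ind∧≤ true true = ≤-refl
ind∧≤ true false = z≤n
ind∧≤ false b = ≤-refl

-- R marks the leaves hanging at v, and G' is G with the edges to these leaves deleted
-- (the leaves stay as isolated vertices, so the vertex set does not change).
module Prune {n} (G : Graph n) (v : Fin n) where
  R : Fin n → Bool
  R w = adj G v w ∧ isLeafᵇ G w

  G' : Graph n
  G' = record { adj = λ a b → adj G a b ∧ not (R a ∨ R b)
              ; sym = λ a b → cong₂ (λ x y → x ∧ not y) (Graph.sym G a b) (∨-comm (R a) (R b))
              ; irrefl = λ a → cong (_∧ not (R a ∨ R a)) (Graph.irrefl G a) }

  R⇒pendant : ∀ w → R w ≡ true → Adj G v w × Leaf G w
  R⇒pendant w e = ∧-conicalˡ (adj G v w) _ e , isLeafᵇ⇒Leaf G w (∧-conicalʳ (adj G v w) _ e)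

  pendant⇒R : ∀ w → Adj G v w → Leaf G w → R w ≡ true
  pendant⇒R w vw leaf rewrite vw | Leaf⇒isLeafᵇ G w leaf = refl

  R-nbr≡v : ∀ c → R c ≡ true → ∀ y → Adj G c y → y ≡ v
  R-nbr≡v c e y cy with R⇒pendant c e
  ... | vc , c-leaf = leaf-nbr-unique G c-leaf cy (Adj-sym G vc)

  R-v : R v ≡ false
  R-v rewrite Graph.irrefl G v = refl

  R-nbr-of-other : ∀ u → u ≢ v → ∀ w → Adj G u w → R w ≡ false
  R-nbr-of-other u u≢v w uw with R w in e
  ... | true = ⊥-elim (u≢v (R-nbr≡v w e u (Adj-sym G uw)))
  ... | false = refl

  Adj-pruned⇒Adj : ∀ {a b} → Adj G' a b → Adj G a b
  Adj-pruned⇒Adj {a} {b} e with adj G a b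
  ... | true = refl
  ... | false = e

  Adj-pruned⇒unmarked : ∀ {a b} → Adj G' a b → R a ≡ false × R b ≡ false
  Adj-pruned⇒unmarked {a} {b} e with adj G a b | R a | R b
  ... | true | false | false = refl , refl
  ... | true | true | _ = contradiction e λ ()
  ... | true | false | true = contradiction e λ ()
  ... | false | _ | _ = contradiction e λ ()

  adj-pruned-unmarked : ∀ u → u ≢ v → R u ≡ false → ∀ w → adj G' u w ≡ adj G u w
  adj-pruned-unmarked u u≢v ru w rewrite ru with adj G u w in e
  ... | false = refl
  ... | true rewrite R-nbr-of-other u u≢v w e = refl

  adj-pruned-v : ∀ w → adj G' v w ≡ adj G v w ∧ not (R w)
  adj-pruned-v w rewrite R-v = refl

  Adj⇒Adj-pruned : ∀ a b → a ≢ v → R a ≡ false → Adj G a b → Adj G' a b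
  Adj⇒Adj-pruned a b a≢v ra ab = trans (adj-pruned-unmarked a a≢v ra b) ab

  Adj⇒Adj-pruned-v : ∀ b → Adj G v b → R b ≡ false → Adj G' v b
  Adj⇒Adj-pruned-v b vb rb rewrite adj-pruned-v b | rb | vb = refl

  deg-pruned-unmarked : ∀ u → u ≢ v → R u ≡ false → deg G' u ≡ deg G u
  deg-pruned-unmarked u u≢v ru = ΣFin-cong (λ w → cong ind (adj-pruned-unmarked u u≢v ru w))

  deg-pruned≤ : ∀ u → deg G' u ≤ deg G u
  deg-pruned≤ u = ΣFin-mono _ _ (λ w → ind∧≤ (adj G u w) _)

  size-decreases : ∀ c → R c ≡ true → ΣFin (deg G') < ΣFin (deg G)
  size-decreases c e = ΣFin-strict _ _ deg-pruned≤ v (ΣFin-strict _ _ (λ w → ind∧≤ (adj G v w) _) c edge-vc-deleted)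
    where
    edge-vc-deleted : ind (adj G' v c) < ind (adj G v c)
    edge-vc-deleted rewrite adj-pruned-v c | e | proj₁ (R⇒pendant c e) = s≤s z≤n

  pruned-forest : Forest G → Forest G'
  pruned-forest forest cy = forest (record
    { m = Cycle.m cy ; len≥3 = Cycle.len≥3 cy ; c = Cycle.c cy ; inj = Cycle.inj cy
    ; step = λ i → Adj-pruned⇒Adj (Cycle.step cy i) ; close = Adj-pruned⇒Adj (Cycle.close cy) })

  Leaf-pruned⇒Leaf : ∀ u → u ≢ v → R u ≡ false → Leaf G' u → Leaf G u
  Leaf-pruned⇒Leaf u u≢v ru l = trans (sym (deg-pruned-unmarked u u≢v ru)) l

  Leaf⇒Leaf-pruned : ∀ u → u ≢ v → R u ≡ false → Leaf G u → Leaf G' u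
  Leaf⇒Leaf-pruned u u≢v ru l = trans (deg-pruned-unmarked u u≢v ru) l

  -- An isolated edge of G' at v would be an edge to a leaf of G hanging at v, which was deleted.
  pruned-noIsolatedEdges : NoIsolatedEdges G → NoIsolatedEdges G'
  pruned-noIsolatedEdges noIso a b (ab , only-b , only-a) with Adj-pruned⇒unmarked ab
  ... | ra , rb with a ≟F v | b ≟F v
  ... | yes refl | yes refl = Adj-irrefl G (Adj-pruned⇒Adj ab)
  ... | yes refl | no b≢v = contradiction
          (trans (sym (pendant⇒R b (Adj-pruned⇒Adj ab) (unique-nbr⇒Leaf G (Adj-sym G (Adj-pruned⇒Adj ab)) only-v))) rb) λ ()
    where
    only-v : ∀ z → Adj G b z → z ≡ v
    only-v z bz = only-a z (trans (adj-pruned-unmarked b b≢v rb z) bz)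
  ... | no a≢v | yes refl = contradiction
          (trans (sym (pendant⇒R a (Adj-sym G (Adj-pruned⇒Adj ab)) (unique-nbr⇒Leaf G (Adj-pruned⇒Adj ab) only-v))) ra) λ ()
    where
    only-v : ∀ z → Adj G a z → z ≡ v
    only-v z az = only-b z (trans (adj-pruned-unmarked a a≢v ra z) az)
  ... | no a≢v | no b≢v = noIso a b (Adj-pruned⇒Adj ab
                                    , (λ z az → only-b z (trans (adj-pruned-unmarked a a≢v ra z) az))
                                    , (λ z bz → only-a z (trans (adj-pruned-unmarked b b≢v rb z) bz)))

rawWeight : ∀ {n k} → Graph n → EdgeLabelling n k → Fin n → ℕ
rawWeight G f u = ΣFin (λ w → if adj G u w then toℕ (f u w) else 0)

rawWeight-single : ∀ {n k} (G : Graph n) (f : EdgeLabelling n k) u x → Adj G u x → (∀ w → Adj G u w → w ≡ x) →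
             rawWeight G f u ≡ toℕ (f u x)
rawWeight-single G f u x ux h = trans (ΣFin-single _ x z) lem
  where
  z : ∀ w → w ≢ x → (if adj G u w then toℕ (f u w) else 0) ≡ 0
  z w wx with adj G u w in e
  ... | true = ⊥-elim (wx (h w e))
  ... | false = refl
  lem : (if adj G u x then toℕ (f u x) else 0) ≡ toℕ (f u x)
  lem rewrite ux = refl

rawWeight-isolated : ∀ {n k} (G : Graph n) (f : EdgeLabelling n k) u → (∀ w → ¬ Adj G u w) → rawWeight G f u ≡ 0
rawWeight-isolated G f u h = ΣFin-zero _ z
  where
  z : ∀ w → (if adj G u w then toℕ (f u w) else 0) ≡ 0
  z w with adj G u w in e
  ... | true = ⊥-elim (h w e)
  ... | false = refl

toℕ-mod : ∀ k' x → x < suc k' → toℕ (x mod suc k') ≡ x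
toℕ-mod k' x lt = trans (toℕ-fromℕ< _) (m<n⇒m%n≡m lt)

-- Extends a labelling f' of Prune.G' G v to G: the marked leaf of rank i gets the label
-- nth Ls i on its edge to v.
module ExtendLabelling (k' : ℕ) {n} (G : Graph n) (v : Fin n) (Ls : List ℕ) (f' : EdgeLabelling n (suc k'))
           (allLt : ∀ i → nth Ls i < suc k') where
  open Prune G v public

  K = suc k'

  residue : ℕ → Fin K
  residue x = x mod K

  label : Fin n → ℕ
  label a = nth Ls (rank R a)

  marked-label : Fin n → Fin n → Fin K
  marked-label a b = if R b then residue (label b) else residue (label a)

  f : EdgeLabelling n K
  f a b = if R a ∨ R b then marked-label a b else f' a b

  toℕ-residue-label : ∀ a → toℕ (residue (label a)) ≡ label a
  toℕ-residue-label a = toℕ-mod k' (label a) (allLt _)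

  f-unmarked : ∀ a b → R a ≡ false → R b ≡ false → f a b ≡ f' a b
  f-unmarked a b ra rb rewrite ra | rb = refl

  f-v-marked : ∀ c → R c ≡ true → toℕ (f v c) ≡ label c
  f-v-marked c e rewrite e | R-v = toℕ-residue-label c

  f-marked-v : ∀ c → R c ≡ true → toℕ (f c v) ≡ label c
  f-marked-v c e rewrite e | R-v = toℕ-residue-label c

  rawWeight-unmarked : ∀ u → u ≢ v → R u ≡ false → rawWeight G f u ≡ rawWeight G' f' u
  rawWeight-unmarked u uv ru = ΣFin-cong pw
    where
    pw : ∀ w → (if adj G u w then toℕ (f u w) else 0) ≡ (if adj G' u w then toℕ (f' u w) else 0)
    pw w rewrite adj-pruned-unmarked u uv ru w with adj G u w in e
    ... | false = refl
    ... | true rewrite f-unmarked u w ru (R-nbr-of-other u uv w e) = refl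

  rawWeight-marked : ∀ c → R c ≡ true → rawWeight G f c ≡ label c
  rawWeight-marked c e = trans (ΣFin-single _ v z) (lem)
    where
    z : ∀ w → w ≢ v → (if adj G c w then toℕ (f c w) else 0) ≡ 0
    z w wv with adj G c w in a
    ... | true = ⊥-elim (wv (R-nbr≡v c e w a))
    ... | false = refl
    lem : (if adj G c v then toℕ (f c v) else 0) ≡ label c
    lem rewrite Adj-sym G (proj₁ (R⇒pendant c e)) = f-marked-v c e

  rawWeight-v : count R ≡ length Ls → rawWeight G f v ≡ rawWeight G' f' v + sum Ls
  rawWeight-v ce = trans (ΣFin-cong pw) (trans (ΣFin-+ (λ w → if adj G' v w then toℕ (f' v w) else 0)
      (λ w → if R w then label w else 0))
            (cong (rawWeight G' f' v +_) (trans (rank-sum R (nth Ls)) (trans (cong (sumTo (nth Ls)) ce) (sumTo-nth Ls)))))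
    where
    pw : ∀ w → (if adj G v w then toℕ (f v w) else 0) ≡
               (if adj G' v w then toℕ (f' v w) else 0) + (if R w then label w else 0)
    pw w rewrite adj-pruned-v w with R w in e
    ... | true rewrite proj₁ (R⇒pendant w e) | R-v = trans (toℕ-residue-label w) (sym (+-identityˡ _))
    ... | false rewrite R-v with adj G v w
    ...   | true = sym (+-identityʳ _)
    ...   | false = refl

  f-to-marked : ∀ a b → R a ≡ false → R b ≡ true → f a b ≡ residue (label b)
  f-to-marked a b ea eb rewrite ea | eb = refl

  f-from-marked : ∀ a b → R a ≡ true → R b ≡ false → f a b ≡ residue (label a)
  f-from-marked a b ea eb rewrite ea | eb = refl

  symm : (∀ a b → Adj G' a b → f' a b ≡ f' b a) → ∀ a b → Adj G a b → f a b ≡ f b a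
  symm s' a b ab with true-or-false (R a) | true-or-false (R b)
  ... | inj₁ ea | inj₁ eb = contradiction (trans (sym (trans (cong R (sym (R-nbr≡v a ea b ab))) eb)) R-v) λ ()
  ... | inj₁ ea | inj₂ eb = trans (f-from-marked a b ea eb) (sym (f-to-marked b a eb ea))
  ... | inj₂ ea | inj₁ eb = trans (f-to-marked a b ea eb) (sym (f-from-marked b a eb ea))
  ... | inj₂ ea | inj₂ eb = trans (f-unmarked a b ea eb) (trans (s' a b lem) (sym (f-unmarked b a eb ea)))
    where lem : Adj G' a b
          lem rewrite ab | ea | eb = refl

  proper : (∀ u a b → Adj G' u a → Adj G' u b → a ≢ b → f' u a ≢ f' u b) →
           count R ≡ length Ls →
           (∀ i j → i < length Ls → j < length Ls → nth Ls i ≡ nth Ls j → i ≡ j) →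
           (∀ y → Adj G' v y → ∀ i → i < length Ls → toℕ (f' v y) ≢ nth Ls i) →
           ∀ u a b → Adj G u a → Adj G u b → a ≢ b → f u a ≢ f u b
  proper p' ce dist avoid u a b ua ub ab with true-or-false (R u)
  ... | inj₁ eu = λ _ → ab (trans (R-nbr≡v u eu a ua) (sym (R-nbr≡v u eu b ub)))
  ... | inj₂ eu with u ≟F v
  ...   | no uv = λ e → p' u a b (Adj⇒Adj-pruned u a uv eu ua) (Adj⇒Adj-pruned u b uv eu ub) ab
            (trans (sym (f-unmarked u a eu (R-nbr-of-other u uv a ua))) (trans e (f-unmarked u b eu (R-nbr-of-other u uv b ub))))
  ...   | yes refl = pv a b ua ub ab
    where
    pv : ∀ a b → Adj G v a → Adj G v b → a ≢ b → f v a ≢ f v b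
    pv a b ua ub ab with true-or-false (R a) | true-or-false (R b)
    ... | inj₁ ea | inj₁ eb = λ e → ab (rank-injective R a b ea eb
              (dist _ _ (subst (_ <_) ce (rank-< R a ea)) (subst (_ <_) ce (rank-< R b eb))
                (trans (sym (f-v-marked a ea)) (trans (cong toℕ e) (f-v-marked b eb)))))
    ... | inj₁ ea | inj₂ eb = λ e → avoid b (Adj⇒Adj-pruned-v b ub eb) (rank R a) (subst (_ <_) ce (rank-< R a ea))
              (trans (cong toℕ (sym (f-unmarked v b R-v eb))) (trans (cong toℕ (sym e)) (f-v-marked a ea)))
    ... | inj₂ ea | inj₁ eb = λ e → avoid a (Adj⇒Adj-pruned-v a ua ea) (rank R b) (subst (_ <_) ce (rank-< R b eb))
              (trans (cong toℕ (sym (f-unmarked v a R-v ea))) (trans (cong toℕ e) (f-v-marked b eb)))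
    ... | inj₂ ea | inj₂ eb = λ e → p' v a b (Adj⇒Adj-pruned-v a ua ea) (Adj⇒Adj-pruned-v b ub eb) ab
              (trans (sym (f-unmarked v a R-v ea)) (trans e (f-unmarked v b R-v eb)))

module Residues (H : ℕ) where
  K : ℕ
  K = suc (H + H)

  %-absorbˡ : ∀ a b → (a % K + b) % K ≡ (a + b) % K
  %-absorbˡ a b = trans (%-distribˡ-+ (a % K) b K) (trans (cong (λ z → (z + b % K) % K) (m%n%n≡m%n a K))
                 (sym (%-distribˡ-+ a b K)))

  %-absorbʳ : ∀ a b → (a + b % K) % K ≡ (a + b) % K
  %-absorbʳ a b = trans (cong (_% K) (+-comm a (b % K))) (trans (%-absorbˡ b a) (cong (_% K) (+-comm b a)))

  %-mK : ∀ a m → (a + m * K) % K ≡ a % K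
  %-mK a m = [m+kn]%n≡m%n a m K

  %-K : ∀ a → (a + K) % K ≡ a % K
  %-K a = [m+n]%n≡m%n a K

  +-%-inverse : ∀ a c → a < K → ((a + c) % K + (K ∸ c % K)) % K ≡ a
  +-%-inverse a c a<K = begin
    ((a + c) % K + (K ∸ r)) % K  ≡⟨ %-absorbˡ (a + c) (K ∸ r) ⟩
    (a + c + (K ∸ r)) % K        ≡⟨ cong (λ z → (a + z + (K ∸ r)) % K) (m≡m%n+[m/n]*n c K) ⟩
    (a + (r + q * K) + (K ∸ r)) % K ≡⟨ cong (_% K)
        (solve 4 (λ a r x y → a :+ (r :+ x) :+ y := a :+ (r :+ y) :+ x) refl a r (q * K) (K ∸ r)) ⟩
    (a + (r + (K ∸ r)) + q * K) % K ≡⟨ cong (λ z → (a + z + q * K) % K) (m+[n∸m]≡n (<⇒≤ (m%n<n c K))) ⟩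
    (a + K + q * K) % K          ≡⟨ %-mK (a + K) q ⟩
    (a + K) % K                  ≡⟨ %-K a ⟩
    a % K                        ≡⟨ m<n⇒m%n≡m a<K ⟩
    a ∎
    where
    open ≡-Reasoning
    r = c % K
    q = c / K

  +-%-cancelʳ : ∀ {a b} c → a < K → b < K → (a + c) % K ≡ (b + c) % K → a ≡ b
  +-%-cancelʳ c a<K b<K e =
    trans (sym (+-%-inverse _ c a<K)) (trans (cong (λ z → (z + (K ∸ c % K)) % K) e) (+-%-inverse _ c b<K))

  %-below-2K : ∀ x → x < K + K → x % K ≡ x ⊎ x % K + K ≡ x
  %-below-2K x x<2K with x <? K
  ... | yes x<K = inj₁ (m<n⇒m%n≡m x<K)
  ... | no x≮K = inj₂ (trans (cong (_+ K) x%K≡x∸K) (m∸n+n≡m K≤x))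
    where
    K≤x = ≮⇒≥ x≮K
    x%K≡x∸K : x % K ≡ x ∸ K
    x%K≡x∸K = trans (cong (_% K) (sym (m∸n+n≡m K≤x))) (trans (%-K (x ∸ K))
          (m<n⇒m%n≡m (+-cancelʳ-< K _ _ (subst (_< K + K) (sym (m∸n+n≡m K≤x)) x<2K))))

  -- lo e and hi (lo e) = K − lo e form the class of e : Fin H; the H classes partition
  -- the nonzero residues, and each class sums to K.
  lo : Fin H → ℕ
  lo e = suc (toℕ e)

  lo≤H : ∀ e → lo e ≤ H
  lo≤H e = toℕ<n e

  hi : ℕ → ℕ
  hi c = K ∸ c

  KH : K ∸ H ≡ suc H
  KH = trans (cong (_∸ H) (sym (+-suc H H))) (m+n∸m≡n H (suc H))

  hi≥ : ∀ e → suc H ≤ hi (lo e)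
  hi≥ e = subst (_≤ hi (lo e)) KH (∸-monoʳ-≤ K (lo≤H e))

  hi<K : ∀ e → hi (lo e) < K
  hi<K e = ∸-monoʳ-< {m = K} {n = lo e} {o = 0} (s≤s z≤n) (≤-trans (lo≤H e) (≤-trans (m≤m+n H H) (n≤1+n _)))

  hi≢0 : ∀ e → hi (lo e) ≢ 0
  hi≢0 e q = <⇒≱ (≤-trans (s≤s z≤n) (hi≥ e)) (≤-reflexive q)

  lo<K : ∀ e → lo e < K
  lo<K e = s≤s (≤-trans (lo≤H e) (m≤m+n H H))

  lo≢hi : ∀ e e' → lo e ≢ hi (lo e')
  lo≢hi e e' q = <⇒≱ (s≤s (lo≤H e)) (≤-trans (hi≥ e') (≤-reflexive (sym q)))

  lo-injective : ∀ e e' → lo e ≡ lo e' → e ≡ e'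
  lo-injective e e' q = toℕ-injective (suc-injective q)

  hi-injective : ∀ e e' → hi (lo e) ≡ hi (lo e') → e ≡ e'
  hi-injective e e' q = lo-injective e e' (∸-cancelˡ-≡ (≤-trans (lo≤H e) (≤-trans (m≤m+n H H) (n≤1+n _)))
                                          (≤-trans (lo≤H e') (≤-trans (m≤m+n H H) (n≤1+n _))) q)

  lo+hi : ∀ e → lo e + hi (lo e) ≡ K
  lo+hi e = m+[n∸m]≡n (≤-trans (lo≤H e) (≤-trans (m≤m+n H H) (n≤1+n _)))

  pairs : ∀ m → (Fin m → Fin H) → List ℕ
  pairs zero E = []
  pairs (suc m) E = lo (E zero) ∷ hi (lo (E zero)) ∷ pairs m (λ i → E (suc i))

  length-pairs : ∀ m E → length (pairs m E) ≡ m + m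
  length-pairs zero E = refl
  length-pairs (suc m) E = cong suc (trans (cong suc (length-pairs m _)) (sym (+-suc m m)))

  sum-pairs : ∀ m E → sum (pairs m E) ≡ m * K
  sum-pairs zero E = refl
  sum-pairs (suc m) E = trans (sym (+-assoc (lo (E zero)) _ _))
                          (cong₂ _+_ (lo+hi (E zero)) (sum-pairs m _))

  All-pairs : ∀ {P : ℕ → Set} m E → (∀ i → P (lo (E i)) × P (hi (lo (E i)))) → All P (pairs m E)
  All-pairs zero E h = []
  All-pairs (suc m) E h = proj₁ (h zero) ∷ proj₂ (h zero) ∷ All-pairs m _ (λ i → h (suc i))

  avoid-val : ∀ m E y e → (y ≡ lo e ⊎ y ≡ hi (lo e)) → (∀ i → E i ≢ e) → All (_≢ y) (pairs m E)
  avoid-val m E y e (inj₁ r) ne = All-pairs m E (λ i → (λ q → ne i (lo-injective _ _ (trans q r))) ,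
                                                     (λ q → lo≢hi e (E i) (sym (trans q r))))
  avoid-val m E y e (inj₂ r) ne = All-pairs m E (λ i → (λ q → lo≢hi (E i) e (trans q r)) ,
                                                     (λ q → ne i (hi-injective _ _ (trans q r))))

  Unique-pairs : ∀ m E → (∀ i j → E i ≡ E j → i ≡ j) → Unique (pairs m E)
  Unique-pairs zero E inj = []
  Unique-pairs (suc m) E inj =
    (lo≢hi (E zero) (E zero) ∷ All-pairs m _ (λ i → (λ q → ne i (lo-injective _ _ q)) , lo≢hi (E zero) (E (suc i))))
    ∷ All-pairs m _ (λ i → (λ q → lo≢hi (E (suc i)) (E zero) (sym q)) , λ q → ne i (hi-injective _ _ q))
    ∷ Unique-pairs m _ (λ i j q → fsuc-inj (inj (suc i) (suc j) q))
    where
    ne : ∀ i → E zero ≢ E (suc i)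
    ne i q with inj zero (suc i) q
    ... | ()

  classify : ∀ x → 1 ≤ x → x < K → Σ (Fin H) λ e → x ≡ lo e ⊎ x ≡ hi (lo e)
  classify (suc x) (s≤s z≤n) lt with suc x ≤? H
  ... | yes le = fromℕ< le , inj₁ (cong suc (sym (toℕ-fromℕ< le)))
  ... | no gt = fromℕ< {m = K ∸ suc (suc x)} lt2 , inj₂ eq
    where
    h1 : suc H ≤ suc x
    h1 = ≰⇒> gt
    lt2 : K ∸ suc (suc x) < H
    lt2 = subst (_≤ H) (+-∸-assoc 1 (s≤s⁻¹ lt))
            (m≤n+o⇒m∸n≤o (H + H) x (+-monoˡ-≤ H (s≤s⁻¹ h1)))
    eq : suc x ≡ hi (suc (toℕ (fromℕ< lt2)))
    eq rewrite toℕ-fromℕ< lt2 =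
      sym (trans (cong (K ∸_) (sym (+-∸-assoc 1 lt))) (m∸[m∸n]≡n (<⇒≤ lt)))

  InClasses : List (Fin H) → ℕ → Set
  InClasses F y = y ≡ 0 ⊎ Σ (Fin H) λ e → (y ≡ lo e ⊎ y ≡ hi (lo e)) × e ∈ F

  pairs-nz : ∀ m E → All (_≢ 0) (pairs m E)
  pairs-nz m E = All-pairs m E (λ i → (λ ()) , hi≢0 (E i))

  pairs-ltK : ∀ m E → All (_< K) (pairs m E)
  pairs-ltK m E = All-pairs m E (λ i → lo<K (E i) , hi<K (E i))

  pairs-av : ∀ F m E → (∀ i → All (E i ≢_) F) → ∀ y → InClasses F y → All (_≢ y) (pairs m E)
  pairs-av F m E avF y (inj₁ refl) = pairs-nz m E
  pairs-av F m E avF y (inj₂ (e , ye , eF)) = avoid-val m E y e ye (λ i → All.lookup (avF i) eF)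

  -- core followed by m whole classes chosen outside F.
  record Padded (core : List ℕ) (F : List (Fin H)) (m : ℕ) : Set where
    field
      Ls : List ℕ
      len : length Ls ≡ length core + (m + m)
      sum≡ : sum Ls ≡ sum core + m * K
      <K : All (_< K) core → All (_< K) Ls
      dist : Unique core → Unique Ls
      nonzero : All (_≢ 0) core → All (_≢ 0) Ls
      av : ∀ y → InClasses F y → All (_≢ y) core → All (_≢ y) Ls

  pad : ∀ core F m → length F + m ≤ H → All (InClasses F) core → Padded core F m
  pad core F m le hc with distinct-avoiding H m F le
  ... | E , inj , avF = record
    { Ls = core ++ pairs m E
    ; len = trans (length-++ core) (cong (length core +_) (length-pairs m E))
    ; sum≡ = trans (sum-++ core _) (cong (sum core +_) (sum-pairs m E))
    ; <K = λ c → All.++⁺ c (pairs-ltK m E)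
    ; dist = λ dc → AllPairs.++⁺ dc (Unique-pairs m E inj) (mapAll hc)
    ; nonzero = λ c → All.++⁺ c (pairs-nz m E)
    ; av = λ y cy c → All.++⁺ c (pairs-av F m E avF y cy) }
    where
    mapAll : ∀ {xs} → All (InClasses F) xs → All (λ x → All (x ≢_) (pairs m E)) xs
    mapAll [] = []
    mapAll (c ∷ cs) = All.map ≢-sym (pairs-av F m E avF _ c) ∷ mapAll cs

  lo-fromℕ< : ∀ j (lt : j < H) → lo (fromℕ< lt) ≡ suc j
  lo-fromℕ< j lt = cong suc (toℕ-fromℕ< lt)

  D : ℕ
  D = pred (H + H)

  half : ∀ d → Σ ℕ λ m → d ≡ m + m ⊎ d ≡ suc (m + m)
  half zero = 0 , inj₁ refl
  half (suc d) with half d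
  ... | m , inj₁ e = m , inj₂ (cong suc e)
  ... | m , inj₂ e = suc m , inj₁ (trans (cong suc e) (cong suc (sym (+-suc m m))))

  halve< : ∀ a b → a + a < b + b → a < b
  halve< a b lt with a <? b
  ... | yes l = l
  ... | no nl = ⊥-elim (<⇒≱ lt (+-mono-≤ (≮⇒≥ nl) (≮⇒≥ nl)))

  halve≤ : ∀ a b → a + a ≤ b + b → a ≤ b
  halve≤ a b le with a ≤? b
  ... | yes l = l
  ... | no nl = ⊥-elim (<⇒≱ (+-mono-< (≰⇒> nl) (≰⇒> nl)) le)

  record StarLabels (d : ℕ) : Set where
    field
      Ls : List ℕ
      len : length Ls ≡ d
      <K : All (_< K) Ls
      dist : Unique Ls
      total∉ : All (_≢ sum Ls % K) Ls
      nonzero : d ≢ D → All (_≢ 0) Ls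

  2m+3 : ∀ m → suc (suc m + suc m) ≡ 3 + (m + m)
  2m+3 m = cong (λ z → suc (suc z)) (+-suc m m)

  sucpred : ∀ {a} → 1 ≤ a → suc (pred a) ≡ a
  sucpred {suc a} _ = refl

  starLabels-full : ∀ m → suc (suc m + suc m) ≡ D → StarLabels (suc (suc m + suc m))
  starLabels-full m eD = record { Ls = Ls ; len = trans (Padded.len b) (sym (2m+3 m)) ; <K = Padded.<K b lk
      ; dist = Padded.dist b dc ; total∉ = subst (λ t → All (_≢ t) Ls) (sym tE) tl ; nonzero = λ ne → ⊥-elim (ne eD) }
    where
    HH : (suc (suc m)) + (suc (suc m)) ≡ H + H
    HH = trans (cong suc (+-suc (suc m) (suc m))) (trans (cong suc eD)
        (sucpred (≤-trans (s≤s z≤n) (≤-trans (≤-reflexive eD) pred[n]≤n))))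
    mH : 2 + m ≤ H
    mH = halve≤ (2 + m) H (≤-reflexive HH)
    l0 : 0 < H
    l0 = ≤-trans (s≤s z≤n) mH
    l1 : 1 < H
    l1 = ≤-trans (s≤s (s≤s z≤n)) mH
    e0 = fromℕ< l0
    e1 = fromℕ< l1
    core = 0 ∷ lo e0 ∷ hi (lo e1) ∷ []
    F = e0 ∷ e1 ∷ []
    b = pad core F m mH (inj₁ refl ∷ inj₂ (e0 , inj₁ refl , here refl) ∷ inj₂ (e1 , inj₂ refl , there (here refl)) ∷ [])
    Ls = Padded.Ls b
    e01 : e1 ≢ e0
    e01 q = lem (trans (sym (lo-fromℕ< 1 l1)) (trans (cong lo q) (lo-fromℕ< 0 l0)))
      where lem : 2 ≢ 1
            lem ()
    lk : All (_< K) core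
    lk = s≤s z≤n ∷ lo<K e0 ∷ hi<K e1 ∷ []
    dc : Unique core
    dc = ((λ q → lem (sym q)) ∷ (λ q → hi≢0 e1 (sym q)) ∷ []) ∷ (lo≢hi e0 e1 ∷ []) ∷ [] ∷ []
      where lem : lo e0 ≢ 0
            lem ()
    csum : sum core ≡ hi (lo e0)
    csum = trans (cong (λ z → z + (hi (lo e1) + 0)) (lo-fromℕ< 0 l0))
             (trans (cong (λ z → suc (K ∸ z + 0)) (lo-fromℕ< 1 l1))
               (trans (cong suc (+-identityʳ _)) (trans (sym (+-∸-assoc 1 {K} {2}
                   (s≤s (≤-trans (≤-trans (s≤s z≤n) mH) (m≤m+n H H)))))
                 (cong (K ∸_) (sym (lo-fromℕ< 0 l0))))))
    tE : sum Ls % K ≡ hi (lo e0)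
    tE = trans (cong (_% K) (Padded.sum≡ b)) (trans (%-mK (sum core) m) (trans (cong (_% K) csum) (m<n⇒m%n≡m (hi<K e0))))
    tl : All (_≢ hi (lo e0)) Ls
    tl = Padded.av b _ (inj₂ (e0 , inj₂ refl , here refl))
           ((λ q → hi≢0 e0 (sym q)) ∷ lo≢hi e0 e0 ∷ (λ q → e01 (hi-injective e1 e0 q)) ∷ [])

  starLabels-odd : ∀ m → suc (suc m + suc m) ≢ D → suc (suc m + suc m) < D → StarLabels (suc (suc m + suc m))
  starLabels-odd m nD lt = record { Ls = Ls ; len = trans (Padded.len b) (sym (2m+3 m)) ; <K = Padded.<K b lk
      ; dist = Padded.dist b dc ; total∉ = subst (λ t → All (_≢ t) Ls) (sym tE) (Padded.av b 0 (inj₁ refl) cnz)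
      ; nonzero = λ _ → Padded.nonzero b cnz }
    where
    HH : suc (suc (suc m + suc m)) < H + H
    HH = ≤-trans (s≤s lt) (≤-reflexive (sucpred (≤-trans (s≤s z≤n) (≤-trans (<⇒≤ lt) pred[n]≤n))))
    mH : 3 + m ≤ H
    mH = halve< (2 + m) H (subst (_< H + H) (sym (cong suc (+-suc (suc m) (suc m)))) HH)
    l0 : 0 < H
    l0 = ≤-trans (s≤s z≤n) mH
    l1 : 1 < H
    l1 = ≤-trans (s≤s (s≤s z≤n)) mH
    l2 : 2 < H
    l2 = ≤-trans (s≤s (s≤s (s≤s z≤n))) mH
    e0 = fromℕ< l0
    e1 = fromℕ< l1
    e2 = fromℕ< l2
    core = lo e0 ∷ lo e1 ∷ hi (lo e2) ∷ []
    F = e0 ∷ e1 ∷ e2 ∷ []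
    b = pad core F m mH (inj₂ (e0 , inj₁ refl , here refl) ∷ inj₂ (e1 , inj₁ refl , there (here refl))
                            ∷ inj₂ (e2 , inj₂ refl , there (there (here refl))) ∷ [])
    Ls = Padded.Ls b
    lk : All (_< K) core
    lk = lo<K e0 ∷ lo<K e1 ∷ hi<K e2 ∷ []
    cnz : All (_≢ 0) core
    cnz = (λ ()) ∷ (λ ()) ∷ hi≢0 e2 ∷ []
    dc : Unique core
    dc = ((λ q → lem (trans (sym (lo-fromℕ< 0 l0)) (trans q (lo-fromℕ< 1 l1)))) ∷ lo≢hi e0 e2 ∷ [])
         ∷ (lo≢hi e1 e2 ∷ []) ∷ [] ∷ []
      where lem : 1 ≢ 2
            lem ()
    csum : sum core ≡ K
    csum = trans (cong₂ (λ x y → x + (y + (K ∸ lo e2 + 0))) (lo-fromℕ< 0 l0) (lo-fromℕ< 1 l1))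
             (trans (cong (λ z → 3 + (K ∸ z + 0)) (lo-fromℕ< 2 l2))
               (trans (cong (3 +_) (+-identityʳ _)) (m+[n∸m]≡n {3} {K}
                   (s≤s (≤-trans (s≤s (s≤s z≤n)) (≤-trans mH (m≤m+n H H)))))))
    tE : sum Ls % K ≡ 0
    tE = trans (cong (_% K) (Padded.sum≡ b)) (trans (%-mK (sum core) m) (trans (cong (_% K) csum) (%-K 0)))

  mK0 : ∀ m → (m * K) % K ≡ 0
  mK0 m = %-mK 0 m

  -- Even d: d/2 classes, total 0.  Odd d < D: core 1, 2, K − 3 (total K) plus classes.
  -- Odd d = D, where the classes do not suffice: core 0, 1, K − 2 with total K − 1, the
  -- missing half of the class of 1; the label 0 is allowed here since v is then a full star centre.
  starLabels : ∀ d → 2 ≤ d → d ≤ D → StarLabels d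
  starLabels d l2 lD with half d
  ... | m , inj₁ refl = record { Ls = Padded.Ls b ; len = Padded.len b ; <K = Padded.<K b []
      ; dist = Padded.dist b [] ; total∉ = subst (λ t → All (_≢ t) (Padded.Ls b)) (sym t0) nz0 ; nonzero = λ _ → nz0 }
    where
    mH : m ≤ H
    mH = halve≤ m H (≤-trans lD (≤-trans pred-≤ ≤-refl))
      where pred-≤ : pred (H + H) ≤ H + H
            pred-≤ = pred[n]≤n
    b = pad [] [] m mH []
    t0 : sum (Padded.Ls b) % K ≡ 0
    t0 = trans (cong (_% K) (Padded.sum≡ b)) (mK0 m)
    nz0 : All (_≢ 0) (Padded.Ls b)
    nz0 = Padded.nonzero b []
  ... | zero , inj₂ refl = ⊥-elim (<⇒≱ l2 (s≤s z≤n))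
  ... | suc m , inj₂ refl with d ≟ D
  ...   | yes eD = starLabels-full m eD
  ...   | no nD = starLabels-odd m (λ e → nD e) (≤∧≢⇒< lD nD)

  -- Labels for the leaves at v when its remaining edge vx carries the label p and x has
  -- weight W: the new weight p + Σ Ls of v must differ from W and from every label.
  record PendantLabels (p W d : ℕ) : Set where
    field
      Ls : List ℕ
      len : length Ls ≡ d
      <K : All (_< K) Ls
      dist : Unique Ls
      nonzero : All (_≢ 0) Ls
      np : All (_≢ p) Ls
      total≢W : (p + sum Ls) % K ≢ W
      total∉ : All (_≢ (p + sum Ls) % K) Ls

  Kp≢p : ∀ p → p < K → K ∸ p ≢ p
  Kp≢p p lt e = m+m≢1+n+n p H (trans (sym (cong (_+ p) e)) (m∸n+n≡m (<⇒≤ lt)))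

  Kp<K : ∀ p → 1 ≤ p → p < K → K ∸ p < K
  Kp<K p l lt = ∸-monoʳ-< {m = K} {n = p} {o = 0} l (<⇒≤ lt)

  Kp≢0 : ∀ p → p < K → K ∸ p ≢ 0
  Kp≢0 p lt e = <⇒≱ lt (≤-reflexive (trans (sym (m∸n+n≡m (<⇒≤ lt))) (cong (_+ p) e)))

  flipCls : ∀ p e → p < K → (p ≡ lo e ⊎ p ≡ hi (lo e)) → (K ∸ p ≡ lo e ⊎ K ∸ p ≡ hi (lo e))
  flipCls p e lt (inj₁ r) = inj₂ (cong (K ∸_) r)
  flipCls p e lt (inj₂ r) = inj₁ (trans (cong (K ∸_) r) (m∸[m∸n]≡n (<⇒≤ (lo<K e))))

  double-injective : ∀ {x y} → x + x ≡ y + y → x ≡ y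
  double-injective {x} {y} e = ≤-antisym (halve≤ x y (≤-reflexive e)) (halve≤ y x (≤-reflexive (sym e)))

  HfromD : ∀ m → suc (m + m) ≤ D → suc m ≤ H
  HfromD m le = halve≤ (suc m) H (subst (_≤ H + H) (sym (cong suc (+-suc m m)))
                   (≤-trans (s≤s le) (≤-reflexive (sucpred (≤-trans (s≤s z≤n) (≤-trans le pred[n]≤n))))))

  tEq : ∀ p m → p < K → (p + (m * K)) % K ≡ p
  tEq p m lt = trans (%-mK p m) (m<n⇒m%n≡m lt)

  -- Even d: d/2 classes avoiding the class of p, so the weight of v stays p.
  pendantLabels-even : ∀ p W m → 1 ≤ p → p < K → W ≢ p → suc (m + m) ≤ D → PendantLabels p W (m + m)
  pendantLabels-even p W m l1 lt nW le = record
    { Ls = Ls ; len = Padded.len b ; <K = Padded.<K b [] ; dist = Padded.dist b [] ; nonzero = Padded.nonzero b []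
    ; np = np ; total≢W = λ q → nW (trans (sym q) te) ; total∉ = subst (λ t → All (_≢ t) Ls) (sym te) np }
    where
    cp = classify p l1 lt
    b = pad [] (proj₁ cp ∷ []) m (HfromD m le) []
    Ls = Padded.Ls b
    np : All (_≢ p) Ls
    np = Padded.av b p (inj₂ (proj₁ cp , proj₂ cp , here refl)) []
    te : (p + sum Ls) % K ≡ p
    te = trans (cong (λ z → (p + z) % K) (Padded.sum≡ b)) (tEq p m lt)

  -- A single label s ∈ {1, 2, 3}: each of s = p and p + s ≡ W excludes one candidate.
  pendantLabels-1 : ∀ p W → 1 ≤ p → p < K → 2 ≤ D → PendantLabels p W 1
  pendantLabels-1 p W l1 lt l2 = finish (unobstructed-candidate (s≤s (s≤s (s≤s z≤n))) P P? cand Tag tagOf uniq)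
    where
    P : ℕ → Set
    P s = s ≢ p × (p + s) % K ≢ W
    P? : ∀ s → Dec (P s)
    P? s = ¬? (s ≟ p) ×-dec ¬? ((p + s) % K ≟ W)
    cand : Fin 3 → ℕ
    cand i = suc (toℕ i)
    Tag : Fin 2 → ℕ → Set
    Tag zero s = s ≡ p
    Tag (suc _) s = (p + s) % K ≡ W
    tagOf : ∀ i → ¬ P (cand i) → Σ (Fin 2) λ t → Tag t (cand i)
    tagOf i np with cand i ≟ p
    ... | yes e = zero , e
    ... | no ne with (p + cand i) % K ≟ W
    ...   | yes e = suc zero , e
    ...   | no ne2 = ⊥-elim (np (ne , ne2))
    H2 : 2 ≤ H
    H2 = halve< 1 H ((≤-trans (s≤s l2) (≤-reflexive (sucpred (≤-trans (s≤s z≤n) (≤-trans l2 pred[n]≤n))))))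
    c<K : ∀ i → cand i < K
    c<K i = ≤-trans (s≤s (toℕ<n i)) (s≤s (≤-trans (s≤s (s≤s (s≤s z≤n))) (+-mono-≤ H2 (≤-trans (s≤s z≤n) H2))))
    neq : ∀ i j → i <ᶠ j → cand i ≢ cand j
    neq i j l e = <ᶠ-irrefl (toℕ-injective (suc-injective e)) l
    uniq : ∀ t i j → i <ᶠ j → Tag t (cand i) → Tag t (cand j) → ⊥
    uniq zero i j l a b = neq i j l (trans a (sym b))
    uniq (suc zero) i j l a b = neq i j l (+-%-cancelʳ p (c<K i) (c<K j)
          (trans (cong (_% K) (+-comm (cand i) p)) (trans (trans a (sym b)) (cong (_% K) (+-comm p (cand j))))))
    p≢0 : p ≢ 0
    p≢0 e = <⇒≱ l1 (≤-reflexive e)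
    finish : Σ (Fin 3) (λ i → P (cand i)) → PendantLabels p W 1
    finish (i , ne , nW) = record
      { Ls = cand i ∷ [] ; len = refl ; <K = c<K i ∷ [] ; dist = [] ∷ [] ; nonzero = (λ ()) ∷ [] ; np = ne ∷ []
      ; total≢W = λ q → nW (trans (cong (λ z → (p + z) % K) (sym (+-identityʳ (cand i)))) q)
      ; total∉ = (λ q → p≢0 (+-%-cancelʳ (cand i) lt (s≤s z≤n)
                 (trans (trans (cong (λ z → (p + z) % K) (sym (+-identityʳ (cand i)))) (sym q))
                     (sym (m<n⇒m%n≡m (c<K i)))))) ∷ [] }

  shiftK : ∀ x → (x + x) + K ≡ suc ((x + H) + (x + H))
  shiftK x = solve 2 (λ x h → (x :+ x) :+ (con 1 :+ (h :+ h)) := con 1 :+ ((x :+ h) :+ (x :+ h))) refl x H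

  double-%-injective : ∀ x y → x + x < K + K → y + y < K + K → (x + x) % K ≡ (y + y) % K → x ≡ y
  double-%-injective x y lx ly e with %-below-2K (x + x) lx | %-below-2K (y + y) ly
  ... | inj₁ ex | inj₁ ey = double-injective (trans (sym ex) (trans e ey))
  ... | inj₁ ex | inj₂ ey = ⊥-elim (m+m≢1+n+n y (x + H) (trans (sym ey) (trans (cong (_+ K) (trans (sym e) ex)) (shiftK x))))
  ... | inj₂ ex | inj₁ ey = ⊥-elim (m+m≢1+n+n x (y + H) (trans (sym ex) (trans (cong (_+ K) (trans e ey)) (shiftK y))))
  ... | inj₂ ex | inj₂ ey = double-injective (trans (sym ex) (trans (cong (_+ K) e) ey))

  -- Core K − p, y, z with y + z ≡ p, so the weight of v stays p; y ∈ {1, …, 5} avoids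
  -- four conditions, each excluding at most one candidate.
  pendantLabels-odd : ∀ p W m → 1 ≤ p → p < K → W ≢ p →
      suc (suc (suc m + suc m)) ≤ D → PendantLabels p W (suc (suc m + suc m))
  pendantLabels-odd p W m l1 lt nW le = finish
      (unobstructed-candidate (s≤s (s≤s (s≤s (s≤s (s≤s z≤n))))) P P? cand Tag tagOf uniq)
    where
    HH : suc (suc (suc (suc m + suc m))) ≤ H + H
    HH = ≤-trans (s≤s le) (≤-reflexive (sucpred (≤-trans (s≤s z≤n) (≤-trans le pred[n]≤n))))
    mH : 3 + m ≤ H
    mH = halve< (2 + m) H (subst (_≤ H + H) (cong (λ z → suc (suc (suc z))) (sym (+-suc m (suc m)))) HH)
    p≢0 : p ≢ 0
    p≢0 e = <⇒≱ l1 (≤-reflexive e)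
    z : ℕ → ℕ
    z y = (p + (K ∸ y)) % K
    z<K : ∀ y → z y < K
    z<K y = m%n<n (p + (K ∸ y)) K
    Z : ∀ y → y ≤ K → (y + z y) % K ≡ p
    Z y yK = trans (%-absorbʳ y (p + (K ∸ y))) (trans (cong (_% K) e) (trans (%-K p) (m<n⇒m%n≡m lt)))
      where
      e : y + (p + (K ∸ y)) ≡ p + K
      e = trans (sym (+-assoc y p _)) (trans (cong (_+ (K ∸ y)) (+-comm y p))
            (trans (+-assoc p y _) (cong (p +_) (m+[n∸m]≡n yK))))
    P : ℕ → Set
    P y = y ≢ p × y ≢ K ∸ p × z y ≢ K ∸ p × y ≢ z y × z y ≢ 0 × z y ≢ p
    P? : ∀ y → Dec (P y)
    P? y = ¬? (y ≟ p) ×-dec ¬? (y ≟ K ∸ p) ×-dec ¬? (z y ≟ K ∸ p)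
        ×-dec ¬? (y ≟ z y) ×-dec ¬? (z y ≟ 0) ×-dec ¬? (z y ≟ p)
    cand : Fin 5 → ℕ
    cand i = suc (toℕ i)
    neq : ∀ i j → i <ᶠ j → cand i ≢ cand j
    neq i j l e = <ᶠ-irrefl (toℕ-injective (suc-injective e)) l
    c<K : ∀ i → cand i < K
    c<K i = ≤-trans (s≤s (toℕ<n i)) (s≤s (≤-trans (s≤s (s≤s (s≤s (s≤s (s≤s z≤n)))))
        (+-mono-≤ (≤-trans (s≤s (s≤s (s≤s z≤n))) mH) (≤-trans (s≤s (s≤s (s≤s z≤n))) mH))))
    Tag : Fin 4 → ℕ → Set
    Tag zero y = y ≡ p
    Tag (suc zero) y = y ≡ K ∸ p
    Tag (suc (suc zero)) y = z y ≡ K ∸ p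
    Tag (suc (suc (suc _))) y = y ≡ z y
    tagOf : ∀ i → ¬ P (cand i) → Σ (Fin 4) λ t → Tag t (cand i)
    tagOf i np with cand i ≟ p
    ... | yes e = zero , e
    ... | no n1 with cand i ≟ K ∸ p
    ...   | yes e = suc zero , e
    ...   | no n2 with z (cand i) ≟ K ∸ p
    ...     | yes e = suc (suc zero) , e
    ...     | no n3 with cand i ≟ z (cand i)
    ...       | yes e = suc (suc (suc zero)) , e
    ...       | no n4 with z (cand i) ≟ 0
    ...         | yes e = ⊥-elim (n1 (trans (sym (m<n⇒m%n≡m (c<K i))) (trans (cong (_% K) (sym (+-identityʳ (cand i))))
                               (trans (cong (λ w → (cand i + w) % K) (sym e)) (Z (cand i) (<⇒≤ (c<K i)))))))
    ...         | no n5 with z (cand i) ≟ p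
    ...           | yes e = ⊥-elim (c≢0 (+-%-cancelʳ p (c<K i) (s≤s z≤n)
                                 (trans (cong (λ w → (cand i + w) % K) (sym e)) (trans (Z _ (<⇒≤ (c<K i)))
                                     (sym (m<n⇒m%n≡m lt))))))
      where c≢0 : cand i ≢ 0
            c≢0 ()
    ...           | no n6 = ⊥-elim (np (n1 , n2 , n3 , n4 , n5 , n6))
    uniq : ∀ t i j → i <ᶠ j → Tag t (cand i) → Tag t (cand j) → ⊥
    uniq zero i j l a b = neq i j l (trans a (sym b))
    uniq (suc zero) i j l a b = neq i j l (trans a (sym b))
    uniq (suc (suc zero)) i j l a b = neq i j l (∸-cancelˡ-≡ (<⇒≤ (c<K i)) (<⇒≤ (c<K j))
      (+-%-cancelʳ p (Kp<K _ (s≤s z≤n) (c<K i)) (Kp<K _ (s≤s z≤n) (c<K j))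
        (trans (cong (_% K) (+-comm (K ∸ cand i) p)) (trans (trans a (sym b)) (cong (_% K) (+-comm p (K ∸ cand j)))))))
    uniq (suc (suc (suc zero))) i j l a b = neq i j l (double-%-injective (cand i) (cand j) (dbl i) (dbl j)
      (trans (trans (cong (λ w → (cand i + w) % K) a) (Z _ (<⇒≤ (c<K i))))
             (sym (trans (cong (λ w → (cand j + w) % K) b) (Z _ (<⇒≤ (c<K j)))))))
      where
      dbl : ∀ i → cand i + cand i < K + K
      dbl i = +-mono-< (c<K i) (c<K i)
    finish : Σ (Fin 5) (λ i → P (cand i)) → PendantLabels p W (suc (suc m + suc m))
    finish (i , n1 , n2 , n3 , n4 , n5 , n6) = record
      { Ls = Ls ; len = trans (Padded.len b) (sym (2m+3 m))
      ; <K = Padded.<K b (Kp<K p l1 lt ∷ c<K i ∷ z<K y ∷ [])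
      ; dist = Padded.dist b ((≢-sym n2 ∷ ≢-sym n3 ∷ []) ∷ (n4 ∷ []) ∷ [] ∷ [])
      ; nonzero = Padded.nonzero b (Kp≢0 p lt ∷ (λ ()) ∷ n5 ∷ [])
      ; np = np ; total≢W = λ q → nW (trans (sym q) te) ; total∉ = subst (λ t → All (_≢ t) Ls) (sym te) np }
      where
      y = cand i
      zy = z y
      ep = classify p l1 lt
      ey = classify y (s≤s z≤n) (c<K i)
      ez = classify zy (n≢0⇒n>0 n5) (z<K y)
      core = (K ∸ p) ∷ y ∷ zy ∷ []
      F = proj₁ ep ∷ proj₁ ey ∷ proj₁ ez ∷ []
      b = pad core F m mH (inj₂ (proj₁ ep , flipCls p (proj₁ ep) lt (proj₂ ep) , here refl)
                              ∷ inj₂ (proj₁ ey , proj₂ ey , there (here refl))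
                              ∷ inj₂ (proj₁ ez , proj₂ ez , there (there (here refl))) ∷ [])
      Ls = Padded.Ls b
      np : All (_≢ p) Ls
      np = Padded.av b p (inj₂ (proj₁ ep , proj₂ ep , here refl)) (Kp≢p p lt ∷ n1 ∷ n6 ∷ [])
      te : (p + sum Ls) % K ≡ p
      te = begin
        (p + sum Ls) % K                          ≡⟨ cong (λ w → (p + w) % K) (Padded.sum≡ b) ⟩
        (p + (sum core + m * K)) % K              ≡⟨ cong (_% K) (sym (+-assoc p (sum core) (m * K))) ⟩
        (p + sum core + m * K) % K                ≡⟨ %-mK (p + sum core) m ⟩
        (p + ((K ∸ p) + (y + (zy + 0)))) % K       ≡⟨ cong (_% K) (sym (+-assoc p (K ∸ p) _)) ⟩
        (p + (K ∸ p) + (y + (zy + 0))) % K         ≡⟨ cong (λ w → (w + (y + (zy + 0))) % K) (m+[n∸m]≡n (<⇒≤ lt)) ⟩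
        (K + (y + (zy + 0))) % K                   ≡⟨ cong (_% K) (+-comm K _) ⟩
        ((y + (zy + 0)) + K) % K                   ≡⟨ %-K (y + (zy + 0)) ⟩
        (y + (zy + 0)) % K                         ≡⟨ cong (λ w → (y + w) % K) (+-identityʳ zy) ⟩
        (y + zy) % K                               ≡⟨ Z y (<⇒≤ (c<K i)) ⟩
        p ∎
        where open ≡-Reasoning

  pendantLabels : ∀ p W d → 1 ≤ p → p < K → W ≢ p → 1 ≤ d → suc d ≤ D → PendantLabels p W d
  pendantLabels p W d l1 lt nW ld le with half d
  ... | m , inj₁ refl = pendantLabels-even p W m l1 lt nW le
  ... | zero , inj₂ refl = pendantLabels-1 p W l1 lt le
  ... | suc m , inj₂ refl = pendantLabels-odd p W m l1 lt nW le

  -- In a double star the edge vx gets label 0, the other edges at x the labels T and the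
  -- other edges at v the labels Lv, so that x has weight 0 and v has weight 1.
  record DoubleStarLabels : Set where
    field
      T : List ℕ
      Tlen : length T ≡ pred D
      Tlt : All (_< K) T
      Tdist : Unique T
      Tnz : All (_≢ 0) T
      Tsum : sum T % K ≡ 0
      Lv : List ℕ
      Lvlen : length Lv ≡ pred D
      Lvlt : All (_< K) Lv
      Lvdist : Unique Lv
      Lvnz : All (_≢ 0) Lv
      Lv1 : All (_≢ 1) Lv
      Lvsum : sum Lv % K ≡ 1

  doubleStarLabels : 2 ≤ H → DoubleStarLabels
  doubleStarLabels h2 = record
    { T = T ; Tlen = trans (Padded.len bT) (sym (pd1 H h2)) ; Tlt = Padded.<K bT [] ; Tdist = Padded.dist bT []
    ; Tnz = Padded.nonzero bT [] ; Tsum = trans (cong (_% K) (Padded.sum≡ bT)) (mK0 (H ∸ 1))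
    ; Lv = Lv ; Lvlen = trans (Padded.len bV) (sym (pd2 H h2)) ; Lvlt = Padded.<K bV (hi<K e0 ∷ lo<K e1 ∷ [])
    ; Lvdist = Padded.dist bV ((≢-sym (lo≢hi e1 e0) ∷ []) ∷ [] ∷ [])
    ; Lvnz = Padded.nonzero bV (hi≢0 e0 ∷ (λ ()) ∷ [])
    ; Lv1 = Padded.av bV 1 (inj₂ (e0 , inj₁ (sym (lo-fromℕ< 0 l0)) , here refl))
              ((λ q → lo≢hi e0 e0 (trans (lo-fromℕ< 0 l0) (sym q))) ∷ (λ q → two (trans (sym (lo-fromℕ< 1 l1)) q)) ∷ [])
    ; Lvsum = trans (cong (_% K) (Padded.sum≡ bV))
        (trans (%-mK (hi (lo e0) + (lo e1 + 0)) (H ∸ 2)) (trans (cong (_% K) csum)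
            (trans (%-K 1) (m<n⇒m%n≡m (s≤s (≤-trans l0 (m≤m+n H H)))))))
    }
    where
    pd1 : ∀ H → 2 ≤ H → pred (pred (H + H)) ≡ (H ∸ 1) + (H ∸ 1)
    pd1 (suc (suc h)) _ = +-suc h (suc h)
    pd1 zero ()
    pd1 (suc zero) (s≤s ())
    pd2 : ∀ H → 2 ≤ H → pred (pred (H + H)) ≡ 2 + ((H ∸ 2) + (H ∸ 2))
    pd2 (suc (suc h)) _ = trans (+-suc h (suc h)) (cong suc (+-suc h h))
    pd2 zero ()
    pd2 (suc zero) (s≤s ())
    l0 : 0 < H
    l0 = ≤-trans (s≤s z≤n) h2
    l1 : 1 < H
    l1 = h2
    e0 = fromℕ< l0
    e1 = fromℕ< l1
    two : 2 ≢ 1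
    two ()
    bT = pad [] (e0 ∷ []) (H ∸ 1) (≤-reflexive (m+[n∸m]≡n l0)) []
    T = Padded.Ls bT
    bV = pad (hi (lo e0) ∷ lo e1 ∷ []) (e0 ∷ e1 ∷ []) (H ∸ 2) (≤-reflexive (m+[n∸m]≡n h2))
           (inj₂ (e0 , inj₂ refl , here refl) ∷ inj₂ (e1 , inj₁ refl , there (here refl)) ∷ [])
    Lv = Padded.Ls bV
    csum : hi (lo e0) + (lo e1 + 0) ≡ 1 + K
    csum = trans (cong₂ (λ a b → (K ∸ a) + (b + 0)) (lo-fromℕ< 0 l0) (lo-fromℕ< 1 l1)) (+-comm (H + H) 2)

module Invariant (H : ℕ) where
  K : ℕ
  K = suc (H + H)
  D : ℕ
  D = pred (H + H)

  FullStarCentre : ∀ {n} → Graph n → Fin n → Set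
  FullStarCentre G z = deg G z ≡ D × (∀ y → Adj G z y → Leaf G y)

  ZeroLeafEdgesAtFullStars : ∀ {n} → (G : Graph n) → EdgeLabelling n K → Set
  ZeroLeafEdgesAtFullStars G f = ∀ u z → Adj G u z → Leaf G u → toℕ (f u z) ≡ 0 → FullStarCentre G z

  Good : ∀ {n} → Graph n → Set
  Good G = Σ (TwinEdgeColouring G K) λ col → ZeroLeafEdgesAtFullStars G (TwinEdgeColouring.f col)

  Bounded : ∀ {n} → Graph n → Set
  Bounded G = ∀ u → deg G u ≤ D

module StarCase (H : ℕ) {n} (G : Graph n) (v c : Fin n)
  (vc : Adj G v c) (c-leaf : Leaf G c)
  (all-leaves : ∀ y → Adj G v y → Leaf G y)
  (bounded : ∀ u → deg G u ≤ pred (H + H))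
  (noIso : NoIsolatedEdges G)
  (good′ : Invariant.Good H (Prune.G' G v)) where

  open Invariant H
  open Residues H using (StarLabels; starLabels)
  module S = Prune G v

  col′ = proj₁ good′
  f′ = TwinEdgeColouring.f col′
  invariant′ = proj₂ good′

  all-marked : ∀ y → Adj G v y → S.R y ≡ true
  all-marked y a = S.pendant⇒R y a (all-leaves y a)

  v-isolated : ∀ w → ¬ Adj S.G' v w
  v-isolated w a with S.Adj-pruned⇒unmarked a
  ... | _ , rw with trans (sym (all-marked w (S.Adj-pruned⇒Adj a))) rw
  ... | ()

  rawWeight-v′ : rawWeight S.G' f′ v ≡ 0
  rawWeight-v′ = rawWeight-isolated S.G' f′ v v-isolated

  ¬v-leaf : ¬ Leaf G v
  ¬v-leaf lv = noIso v c (vc , (λ w vw → leaf-nbr-unique G lv vw vc) , (λ w cw → leaf-nbr-unique G c-leaf cw (Adj-sym G vc)))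

  d : ℕ
  d = count S.R

  deg-v : deg G v ≡ d
  deg-v = ΣFin-cong pw
    where
    pw : ∀ w → ind (adj G v w) ≡ ind (S.R w)
    pw w with true-or-false (adj G v w)
    ... | inj₁ e = trans (cong ind e) (cong ind (sym (all-marked w e)))
    ... | inj₂ e = trans (cong ind e) (cong ind (sym (cong (_∧ isLeafᵇ G w) e)))

  d≥2 : 2 ≤ d
  d≥2 with ¬Leaf⇒other-nbr G ¬v-leaf vc
  ... | c' , vc' , ne = subst (_≤ d) (cong₂ _+_ (cong ind (all-marked c' vc')) (cong ind (all-marked c vc)))
                          (f+f≤ΣFin (λ w → ind (S.R w)) c' c ne)

  labels : StarLabels d
  labels = starLabels d d≥2 (subst (_≤ D) deg-v (bounded v))

  Ls = StarLabels.Ls labels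

  labels<K : ∀ i → nth Ls i < K
  labels<K = All-nth₀ (s≤s z≤n) (StarLabels.<K labels)

  module E = ExtendLabelling (H + H) G v Ls f′ labels<K

  count≡length : count S.R ≡ length Ls
  count≡length = sym (StarLabels.len labels)

  t : ℕ
  t = sum Ls % K

  weight-v : weight G E.f v ≡ t
  weight-v = cong (_% K) (trans (E.rawWeight-v count≡length) (cong (_+ sum Ls) rawWeight-v′))

  weight-marked : ∀ a → S.R a ≡ true → weight G E.f a ≡ E.label a
  weight-marked a e = trans (cong (_% K) (E.rawWeight-marked a e)) (m<n⇒m%n≡m (labels<K _))

  weight-unmarked : ∀ u → u ≢ v → S.R u ≡ false → weight G E.f u ≡ weight S.G' f′ u
  weight-unmarked u uv ru = cong (_% K) (E.rawWeight-unmarked u uv ru)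

  All-labels : ∀ {P : ℕ → Set} → All P Ls → ∀ a → S.R a ≡ true → P (E.label a)
  All-labels al a e = All-nth al _ (subst (_ <_) count≡length (rank-< S.R a e))

  unmarked-nbr-v : ∀ y → Adj G v y → S.R y ≡ false → ⊥
  unmarked-nbr-v y a r with trans (sym (all-marked y a)) r
  ... | ()

  marked-twin : ∀ a b → Adj G a b → S.R a ≡ true → weight G E.f a ≢ weight G E.f b
  marked-twin a b ab ra q = All-labels (StarLabels.total∉ labels) a ra (begin
    E.label a        ≡⟨ sym (weight-marked a ra) ⟩
    weight G E.f a   ≡⟨ q ⟩
    weight G E.f b   ≡⟨ cong (weight G E.f) (S.R-nbr≡v a ra b ab) ⟩
    weight G E.f v   ≡⟨ weight-v ⟩
    t                ∎)
    where open ≡-Reasoning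

  twin-cases : ∀ a b → Adj G a b → TrueOrFalse (S.R a) → TrueOrFalse (S.R b) → Dec (a ≡ v) → Dec (b ≡ v) →
               weight G E.f a ≢ weight G E.f b
  twin-cases a b ab (inj₁ ra) _ _ _ = marked-twin a b ab ra
  twin-cases a b ab (inj₂ ra) (inj₁ rb) _ _ = marked-twin b a (Adj-sym G ab) rb ∘ sym
  twin-cases a b ab (inj₂ ra) (inj₂ rb) (yes refl) _ q = unmarked-nbr-v b ab rb
  twin-cases a b ab (inj₂ ra) (inj₂ rb) (no av) (yes refl) q = unmarked-nbr-v a (Adj-sym G ab) ra
  twin-cases a b ab (inj₂ ra) (inj₂ rb) (no av) (no bv) q =
    TwinEdgeColouring.twin col′ a b (S.Adj⇒Adj-pruned a b av ra ab)
        (trans (sym (weight-unmarked a av ra)) (trans q (weight-unmarked b bv rb)))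

  twin : ∀ a b → Adj G a b → weight G E.f a ≢ weight G E.f b
  twin a b ab = twin-cases a b ab (true-or-false (S.R a)) (true-or-false (S.R b)) (a ≟F v) (b ≟F v)

  nbr-of-full-leaf : ∀ z → z ≢ v → S.R z ≡ false → FullStarCentre S.G' z → ∀ y → Adj G z y → Dec (y ≡ v) → Leaf G y
  nbr-of-full-leaf z zv rz ex y zy (yes refl) = ⊥-elim (unmarked-nbr-v z (Adj-sym G zy) rz)
  nbr-of-full-leaf z zv rz ex y zy (no yv) = S.Leaf-pruned⇒Leaf y yv (S.R-nbr-of-other z zv y zy)
      (proj₂ ex y (S.Adj⇒Adj-pruned z y zv rz zy))

  invariant-cases : ∀ u z → Adj G u z → Leaf G u → toℕ (E.f u z) ≡ 0 →
         TrueOrFalse (S.R u) → Dec (d ≡ D) → Dec (u ≡ v) → TrueOrFalse (S.R z) → Dec (z ≡ v) → FullStarCentre G z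
  invariant-cases u z uz lu f0 (inj₁ ru) (yes dD) _ _ _ =
      subst (FullStarCentre G) (sym (S.R-nbr≡v u ru z uz)) (trans deg-v dD , all-leaves)
  invariant-cases u z uz lu f0 (inj₁ ru) (no nD) _ _ _ =
    ⊥-elim (All-labels (StarLabels.nonzero labels nD) u ru (trans (sym (E.f-marked-v u ru))
        (trans (cong (λ w → toℕ (E.f u w)) (sym (S.R-nbr≡v u ru z uz))) f0)))
  invariant-cases u z uz lu f0 (inj₂ ru) _ (yes refl) _ _ = ⊥-elim (¬v-leaf lu)
  invariant-cases u z uz lu f0 (inj₂ ru) _ (no uv) (inj₁ rz) _ = ⊥-elim (uv (S.R-nbr≡v z rz u (Adj-sym G uz)))
  invariant-cases u z uz lu f0 (inj₂ ru) _ (no uv) (inj₂ rz) (yes refl) = ⊥-elim (unmarked-nbr-v u (Adj-sym G uz) ru)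
  invariant-cases u z uz lu f0 (inj₂ ru) _ (no uv) (inj₂ rz) (no zv) =
    trans (sym (S.deg-pruned-unmarked z zv rz)) (proj₁ ex) , λ y zy → nbr-of-full-leaf z zv rz ex y zy (y ≟F v)
    where
    ex = invariant′ u z (S.Adj⇒Adj-pruned u z uv ru uz) (S.Leaf⇒Leaf-pruned u uv ru lu)
        (trans (cong toℕ (sym (E.f-unmarked u z ru rz))) f0)

  invariant : ZeroLeafEdgesAtFullStars G E.f
  invariant u z uz lu f0 = invariant-cases u z uz lu f0 (true-or-false (S.R u)) (d ≟ D) (u ≟F v) (true-or-false (S.R z)) (z ≟F v)

  result : Good G
  result = record { f = E.f ; symm = E.symm (TwinEdgeColouring.symm col′)
                  ; proper = E.proper (TwinEdgeColouring.proper col′) count≡length (nth-injective (StarLabels.dist labels)) avoid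
                  ; twin = twin } , invariant
    where
    avoid : ∀ y → Adj S.G' v y → ∀ i → i < length Ls → toℕ (f′ v y) ≢ nth Ls i
    avoid y a = ⊥-elim (v-isolated y a)

-- v has a single non-leaf neighbour x, which is not a full star centre after pruning at v.
module PendantCase (H : ℕ) {n} (G : Graph n) (v x c : Fin n)
  (vx : Adj G v x) (¬x-leaf : ¬ Leaf G x) (vc : Adj G v c) (c-leaf : Leaf G c)
  (leaves : ∀ y → Adj G v y → y ≢ x → Leaf G y)
  (bounded : ∀ u → deg G u ≤ pred (H + H))
  (x-unsaturated : ¬ (deg G x ≡ pred (H + H) × (∀ y → Adj G x y → y ≢ v → Leaf G y)))
  (good′ : Invariant.Good H (Prune.G' G v)) where

  open Invariant H
  open Residues H using (PendantLabels; pendantLabels)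
  module S = Prune G v

  col′ = proj₁ good′
  f′ = TwinEdgeColouring.f col′
  invariant′ = proj₂ good′

  x≢v : x ≢ v
  x≢v refl = Adj-irrefl G vx

  x-unmarked : S.R x ≡ false
  x-unmarked rewrite vx = ¬Leaf⇒isLeafᵇ≡false G x ¬x-leaf

  vx′ : Adj S.G' v x
  vx′ = S.Adj⇒Adj-pruned-v x vx x-unmarked

  only-x′ : ∀ w → Adj S.G' v w → w ≡ x
  only-x′ w a with w ≟F x
  ... | yes e = e
  ... | no ne with S.Adj-pruned⇒unmarked a
  ...   | _ , rw = contradiction (trans (sym (S.pendant⇒R w (S.Adj-pruned⇒Adj a) (leaves w (S.Adj-pruned⇒Adj a) ne))) rw) λ ()

  v-leaf′ : Leaf S.G' v
  v-leaf′ = unique-nbr⇒Leaf S.G' vx′ only-x′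

  p : ℕ
  p = toℕ (f′ v x)

  W : ℕ
  W = weight S.G' f′ x

  rawWeight-v′ : rawWeight S.G' f′ v ≡ p
  rawWeight-v′ = rawWeight-single S.G' f′ v x vx′ only-x′

  p<K : p < K
  p<K = toℕ<n _

  weight-v′ : weight S.G' f′ v ≡ p
  weight-v′ = trans (cong (_% K) rawWeight-v′) (m<n⇒m%n≡m p<K)

  W≢p : W ≢ p
  W≢p e = TwinEdgeColouring.twin col′ v x vx′ (trans weight-v′ (sym e))

  ¬x-full′ : FullStarCentre S.G' x → ⊥
  ¬x-full′ ex = x-unsaturated (trans (sym (S.deg-pruned-unmarked x x≢v x-unmarked)) (proj₁ ex) ,
      λ y xy yv → S.Leaf-pruned⇒Leaf y yv (S.R-nbr-of-other x x≢v y xy)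
             (proj₂ ex y (trans (S.adj-pruned-unmarked x x≢v x-unmarked y) xy)))

  p≢0 : p ≢ 0
  p≢0 e = ¬x-full′ (invariant′ v x vx′ v-leaf′ e)

  d : ℕ
  d = count S.R

  c-marked : S.R c ≡ true
  c-marked = S.pendant⇒R c vc c-leaf

  d≥1 : 1 ≤ d
  d≥1 = subst (_≤ d) (cong ind c-marked) (f≤ΣFin (λ w → ind (S.R w)) c)

  d+1≤D : suc d ≤ pred (H + H)
  d+1≤D = ≤-trans (subst (_≤ deg G v) eq (ΣFin-mono _ _ pw)) (bounded v)
    where
    h : Fin n → ℕ
    h w = ind (S.R w) + point x 1 w
    pw : ∀ w → h w ≤ ind (adj G v w)
    pw w with w ≟F x
    ... | yes refl rewrite x-unmarked | vx = ≤-refl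
    ... | no _ rewrite +-identityʳ (ind (S.R w)) = ind∧≤ (adj G v w) _
    eq : ΣFin h ≡ suc d
    eq = trans (ΣFin-+ (λ w → ind (S.R w)) (point x 1)) (trans (cong (d +_) (ΣFin-point x 1)) (+-comm d 1))

  labels : PendantLabels p W d
  labels = pendantLabels p W d (n≢0⇒n>0 p≢0) p<K W≢p d≥1 d+1≤D

  Ls = PendantLabels.Ls labels

  labels<K : ∀ i → nth Ls i < K
  labels<K = All-nth₀ (s≤s z≤n) (PendantLabels.<K labels)

  module E = ExtendLabelling (H + H) G v Ls f′ labels<K

  count≡length : count S.R ≡ length Ls
  count≡length = sym (PendantLabels.len labels)

  t : ℕ
  t = (p + sum Ls) % K

  weight-v : weight G E.f v ≡ t
  weight-v = cong (_% K) (trans (E.rawWeight-v count≡length) (cong (_+ sum Ls) rawWeight-v′))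

  weight-marked : ∀ a → S.R a ≡ true → weight G E.f a ≡ E.label a
  weight-marked a e = trans (cong (_% K) (E.rawWeight-marked a e)) (m<n⇒m%n≡m (labels<K _))

  weight-unmarked : ∀ u → u ≢ v → S.R u ≡ false → weight G E.f u ≡ weight S.G' f′ u
  weight-unmarked u uv ru = cong (_% K) (E.rawWeight-unmarked u uv ru)

  All-labels : ∀ {P : ℕ → Set} → All P Ls → ∀ a → S.R a ≡ true → P (E.label a)
  All-labels al a e = All-nth al _ (subst (_ <_) count≡length (rank-< S.R a e))

  c≢x : c ≢ x
  c≢x refl = ¬x-leaf c-leaf

  marked-twin : ∀ a b → Adj G a b → S.R a ≡ true → weight G E.f a ≢ weight G E.f b
  marked-twin a b ab ra q = All-labels (PendantLabels.total∉ labels) a ra (begin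
    E.label a        ≡⟨ sym (weight-marked a ra) ⟩
    weight G E.f a   ≡⟨ q ⟩
    weight G E.f b   ≡⟨ cong (weight G E.f) (S.R-nbr≡v a ra b ab) ⟩
    weight G E.f v   ≡⟨ weight-v ⟩
    t                ∎)
    where open ≡-Reasoning

  v-x-twin : ∀ b → Adj G v b → S.R b ≡ false → weight G E.f v ≢ weight G E.f b
  v-x-twin b vb rb q = PendantLabels.total≢W labels (begin
    t                ≡⟨ sym weight-v ⟩
    weight G E.f v   ≡⟨ q ⟩
    weight G E.f b   ≡⟨ cong (weight G E.f) (only-x′ b (S.Adj⇒Adj-pruned-v b vb rb)) ⟩
    weight G E.f x   ≡⟨ weight-unmarked x x≢v x-unmarked ⟩
    W                ∎)
    where open ≡-Reasoning

  twin-cases : ∀ a b → Adj G a b → TrueOrFalse (S.R a) → TrueOrFalse (S.R b) → Dec (a ≡ v) → Dec (b ≡ v) →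
               weight G E.f a ≢ weight G E.f b
  twin-cases a b ab (inj₁ ra) _ _ _ = marked-twin a b ab ra
  twin-cases a b ab (inj₂ ra) (inj₁ rb) _ _ = marked-twin b a (Adj-sym G ab) rb ∘ sym
  twin-cases a b ab (inj₂ ra) (inj₂ rb) (yes refl) (yes refl) q = Adj-irrefl G ab
  twin-cases a b ab (inj₂ ra) (inj₂ rb) (yes refl) (no bv) = v-x-twin b ab rb
  twin-cases a b ab (inj₂ ra) (inj₂ rb) (no av) (yes refl) = v-x-twin a (Adj-sym G ab) ra ∘ sym
  twin-cases a b ab (inj₂ ra) (inj₂ rb) (no av) (no bv) q =
    TwinEdgeColouring.twin col′ a b (S.Adj⇒Adj-pruned a b av ra ab)
        (trans (sym (weight-unmarked a av ra)) (trans q (weight-unmarked b bv rb)))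

  twin : ∀ a b → Adj G a b → weight G E.f a ≢ weight G E.f b
  twin a b ab = twin-cases a b ab (true-or-false (S.R a)) (true-or-false (S.R b)) (a ≟F v) (b ≟F v)

  nbr-of-full-leaf : ∀ z → z ≢ v → S.R z ≡ false → FullStarCentre S.G' z → ∀ y → Adj G z y → Dec (y ≡ v) → Leaf G y
  nbr-of-full-leaf z zv rz ex y zy (yes refl) =
      ⊥-elim (¬x-full′ (subst (FullStarCentre S.G') (only-x′ z (S.Adj⇒Adj-pruned-v z (Adj-sym G zy) rz)) ex))
  nbr-of-full-leaf z zv rz ex y zy (no yv) = S.Leaf-pruned⇒Leaf y yv (S.R-nbr-of-other z zv y zy)
      (proj₂ ex y (S.Adj⇒Adj-pruned z y zv rz zy))

  invariant-cases : ∀ u z → Adj G u z → Leaf G u → toℕ (E.f u z) ≡ 0 →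
         TrueOrFalse (S.R u) → Dec (u ≡ v) → TrueOrFalse (S.R z) → Dec (z ≡ v) → FullStarCentre G z
  invariant-cases u z uz lu f0 (inj₁ ru) _ _ _ =
    ⊥-elim (All-labels (PendantLabels.nonzero labels) u ru (trans (sym (E.f-marked-v u ru))
        (trans (cong (λ w → toℕ (E.f u w)) (sym (S.R-nbr≡v u ru z uz))) f0)))
  invariant-cases u z uz lu f0 (inj₂ ru) (yes refl) _ _ = ⊥-elim (c≢x (leaf-nbr-unique G lu vc vx))
  invariant-cases u z uz lu f0 (inj₂ ru) (no uv) (inj₁ rz) _ = ⊥-elim (uv (S.R-nbr≡v z rz u (Adj-sym G uz)))
  invariant-cases u z uz lu f0 (inj₂ ru) (no uv) (inj₂ rz) (yes refl) =
      ⊥-elim (¬x-leaf (subst (Leaf G) (only-x′ u (S.Adj⇒Adj-pruned-v u (Adj-sym G uz) ru)) lu))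
  invariant-cases u z uz lu f0 (inj₂ ru) (no uv) (inj₂ rz) (no zv) =
    trans (sym (S.deg-pruned-unmarked z zv rz)) (proj₁ ex) , λ y zy → nbr-of-full-leaf z zv rz ex y zy (y ≟F v)
    where
    ex = invariant′ u z (S.Adj⇒Adj-pruned u z uv ru uz) (S.Leaf⇒Leaf-pruned u uv ru lu)
        (trans (cong toℕ (sym (E.f-unmarked u z ru rz))) f0)

  invariant : ZeroLeafEdgesAtFullStars G E.f
  invariant u z uz lu f0 = invariant-cases u z uz lu f0 (true-or-false (S.R u)) (u ≟F v) (true-or-false (S.R z)) (z ≟F v)

  result : Good G
  result = record { f = E.f ; symm = E.symm (TwinEdgeColouring.symm col′)
                  ; proper = E.proper (TwinEdgeColouring.proper col′) count≡length (nth-injective (PendantLabels.dist labels)) avoid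
                  ; twin = twin } , invariant
    where
    avoid : ∀ y → Adj S.G' v y → ∀ i → i < length Ls → toℕ (f′ v y) ≢ nth Ls i
    avoid y a i lt rewrite only-x′ y a = λ q → All-nth (PendantLabels.np labels) i lt (sym q)

module DoubleStarCase (H : ℕ) {n} (G : Graph n) (v x c : Fin n)
  (vx : Adj G v x) (vc : Adj G v c) (c-leaf : Leaf G c) (¬x-leaf : ¬ Leaf G x)
  (v-leaves : ∀ y → Adj G v y → y ≢ x → Leaf G y)
  (x-leaves : ∀ y → Adj G x y → y ≢ v → Leaf G y)
  (deg-v : deg G v ≡ pred (H + H)) (deg-x : deg G x ≡ pred (H + H))
  (good₂ : Invariant.Good H (Prune.G' (Prune.G' G v) x)) where

  open Invariant H
  open Residues H using (DoubleStarLabels; doubleStarLabels; halve<; sucpred)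
  module S1 = Prune G v
  G₁ = S1.G'
  module S2 = Prune G₁ x
  G₂ = S2.G'

  col₂ = proj₁ good₂
  f₂ = TwinEdgeColouring.f col₂
  invariant₂ = proj₂ good₂

  x≢v : x ≢ v
  x≢v refl = Adj-irrefl G vx

  c≢x : c ≢ x
  c≢x refl = ¬x-leaf c-leaf

  x-unmarked₁ : S1.R x ≡ false
  x-unmarked₁ rewrite vx = ¬Leaf⇒isLeafᵇ≡false G x ¬x-leaf

  unmarked-nbr-v≡x : ∀ y → Adj G v y → S1.R y ≡ false → y ≡ x
  unmarked-nbr-v≡x y a r with y ≟F x
  ... | yes e = e
  ... | no ne with trans (sym (S1.pendant⇒R y a (v-leaves y a ne))) r
  ...   | ()

  only-x₁ : ∀ w → Adj G₁ v w → w ≡ x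
  only-x₁ w a = unmarked-nbr-v≡x w (S1.Adj-pruned⇒Adj a) (proj₂ (S1.Adj-pruned⇒unmarked a))

  vx₁ : Adj G₁ v x
  vx₁ = S1.Adj⇒Adj-pruned-v x vx x-unmarked₁

  v-leaf₁ : Leaf G₁ v
  v-leaf₁ = unique-nbr⇒Leaf G₁ vx₁ only-x₁

  adj-x₁ : ∀ w → adj G₁ x w ≡ adj G x w
  adj-x₁ = S1.adj-pruned-unmarked x x≢v x-unmarked₁

  all-marked₂ : ∀ w → Adj G₁ x w → S2.R w ≡ true
  all-marked₂ w a with w ≟F v
  ... | yes refl = S2.pendant⇒R v a v-leaf₁
  ... | no wv = S2.pendant⇒R w a (S1.Leaf⇒Leaf-pruned w wv (S1.R-nbr-of-other x x≢v w (trans (sym (adj-x₁ w)) a))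
                   (x-leaves w (trans (sym (adj-x₁ w)) a) wv))

  x-isolated₂ : ∀ w → ¬ Adj G₂ x w
  x-isolated₂ w a with S2.Adj-pruned⇒unmarked a
  ... | _ , rw with trans (sym (all-marked₂ w (S2.Adj-pruned⇒Adj a))) rw
  ... | ()

  count₂ : count S2.R ≡ pred (H + H)
  count₂ = trans (sym (ΣFin-cong pw)) (trans (S1.deg-pruned-unmarked x x≢v x-unmarked₁) deg-x)
    where
    pw : ∀ w → ind (adj G₁ x w) ≡ ind (S2.R w)
    pw w with true-or-false (adj G₁ x w)
    ... | inj₁ e = trans (cong ind e) (cong ind (sym (all-marked₂ w e)))
    ... | inj₂ e = trans (cong ind e) (cong ind (sym (cong (_∧ isLeafᵇ G₁ w) e)))

  1+count₁ : suc (count S1.R) ≡ pred (H + H)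
  1+count₁ = trans (trans (+-comm 1 _) (sym (trans (ΣFin-+ (λ w → ind (S1.R w)) (point x 1))
      (cong (count S1.R +_) (ΣFin-point x 1)))))
           (trans (ΣFin-cong pw) deg-v)
    where
    pw : ∀ w → ind (S1.R w) + point x 1 w ≡ ind (adj G v w)
    pw w with w ≟F x
    ... | yes refl rewrite x-unmarked₁ | vx = refl
    ... | no wx with true-or-false (adj G v w)
    ...   | inj₁ e rewrite S1.pendant⇒R w e (v-leaves w e wx) | e = refl
    ...   | inj₂ e rewrite e = refl

  D≥2 : 2 ≤ pred (H + H)
  D≥2 = subst (2 ≤_) deg-v (subst (_≤ deg G v) (cong₂ _+_ (ind-adj G v c vc) (ind-adj G v x vx))
          (f+f≤ΣFin (λ w → ind (adj G v w)) c x c≢x))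

  H≥2 : 2 ≤ H
  H≥2 = halve< 1 H (≤-trans (s≤s D≥2) (≤-reflexive (sucpred (≤-trans (s≤s z≤n) (≤-trans D≥2 pred[n]≤n)))))

  labels : DoubleStarLabels
  labels = doubleStarLabels H≥2

  T = DoubleStarLabels.T labels
  Lv = DoubleStarLabels.Lv labels

  r : ℕ
  r = rank S2.R v

  v-marked₂ : S2.R v ≡ true
  v-marked₂ = all-marked₂ v (trans (Graph.sym G₁ x v) vx₁)

  r≤length : r ≤ length T
  r≤length = subst (r ≤_) (sym (DoubleStarLabels.Tlen labels)) (<⇒≤pred (subst (r <_) count₂ (rank-< S2.R v v-marked₂)))

  Lx = insertAt r 0 T

  Lx<K : ∀ i → nth Lx i < K
  Lx<K = All-nth₀ (s≤s z≤n) (All-insertAt r 0 T (s≤s z≤n) (DoubleStarLabels.Tlt labels))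

  module E1 = ExtendLabelling (H + H) G₁ x Lx f₂ Lx<K

  count≡length₂ : count S2.R ≡ length Lx
  count≡length₂ = trans count₂ (trans (sym (sucpred (≤-trans (s≤s z≤n) D≥2)))
          (trans (cong suc (sym (DoubleStarLabels.Tlen labels))) (sym (length-insertAt r 0 T))))

  f₁ = E1.f

  label-v₁ : E1.label v ≡ 0
  label-v₁ = nth-insertAt r 0 T r≤length

  label-other≢0 : ∀ w → S2.R w ≡ true → w ≢ v → E1.label w ≢ 0
  label-other≢0 w rw wv = nth-insertAt-other r 0 T r≤length (DoubleStarLabels.Tnz labels) (rank S2.R w)
                  (λ q → wv (rank-injective S2.R w v rw v-marked₂ q))
                  (subst (rank S2.R w <_) (trans count≡length₂ (length-insertAt r 0 T)) (rank-< S2.R w rw))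

  Lv<K : ∀ i → nth Lv i < K
  Lv<K = All-nth₀ (s≤s z≤n) (DoubleStarLabels.Lvlt labels)

  module E2 = ExtendLabelling (H + H) G v Lv f₁ Lv<K

  count≡length₁ : count S1.R ≡ length Lv
  count≡length₁ = trans (cong pred 1+count₁) (sym (DoubleStarLabels.Lvlen labels))

  f = E2.f

  f₁-vx : toℕ (f₁ v x) ≡ 0
  f₁-vx = trans (E1.f-marked-v v v-marked₂) label-v₁

  weight-x₁ : weight G₁ f₁ x ≡ 0
  weight-x₁ = trans (cong (_% K) (trans (E1.rawWeight-v count≡length₂)
      (cong₂ _+_ (rawWeight-isolated G₂ f₂ x x-isolated₂) (sum-insertAt r 0 T))))
          (DoubleStarLabels.Tsum labels)

  weight-x : weight G f x ≡ 0
  weight-x = trans (cong (_% K) (E2.rawWeight-unmarked x x≢v x-unmarked₁)) weight-x₁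

  rawWeight-v₁ : rawWeight G₁ f₁ v ≡ 0
  rawWeight-v₁ = trans (rawWeight-single G₁ f₁ v x vx₁ only-x₁) f₁-vx

  weight-v : weight G f v ≡ 1
  weight-v = trans (cong (_% K) (trans (E2.rawWeight-v count≡length₁) (cong (_+ sum Lv) rawWeight-v₁)))
      (DoubleStarLabels.Lvsum labels)

  weight-marked₁ : ∀ a → S1.R a ≡ true → weight G f a ≡ E2.label a
  weight-marked₁ a e = trans (cong (_% K) (E2.rawWeight-marked a e)) (m<n⇒m%n≡m (Lv<K (rank S1.R a)))

  nbr-x-unmarked₁ : ∀ a → Adj G₁ x a → S1.R a ≡ false
  nbr-x-unmarked₁ a xa = S1.R-nbr-of-other x x≢v a (trans (sym (adj-x₁ a)) xa)

  weight-marked₂ : ∀ a → S2.R a ≡ true → a ≢ v → weight G f a ≡ E1.label a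
  weight-marked₂ a e av = trans (cong (_% K) (E2.rawWeight-unmarked a av (nbr-x-unmarked₁ a (proj₁ (S2.R⇒pendant a e)))))
                 (trans (cong (_% K) (E1.rawWeight-marked a e)) (m<n⇒m%n≡m (Lx<K (rank S2.R a))))

  weight-unmarked : ∀ u → u ≢ v → S1.R u ≡ false → u ≢ x → S2.R u ≡ false → weight G f u ≡ weight G₂ f₂ u
  weight-unmarked u uv r1 ux r2 = cong (_% K) (trans (E2.rawWeight-unmarked u uv r1) (E1.rawWeight-unmarked u ux r2))

  All-Lv : ∀ {P : ℕ → Set} → All P Lv → ∀ a → S1.R a ≡ true → P (E2.label a)
  All-Lv al a e = All-nth al (rank S1.R a) (subst (rank S1.R a <_) count≡length₁ (rank-< S1.R a e))

  unmarked₂ : ∀ a b → Adj G₁ a b → b ≢ x → S2.R a ≡ false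
  unmarked₂ a b ab bx = go (true-or-false (S2.R a))
    where
    go : TrueOrFalse (S2.R a) → S2.R a ≡ false
    go (inj₁ e) = ⊥-elim (bx (S2.R-nbr≡v a e b ab))
    go (inj₂ e) = e

  marked-twin : ∀ a b → Adj G a b → S1.R a ≡ true → weight G f a ≢ weight G f b
  marked-twin a b ab ra q = All-Lv (DoubleStarLabels.Lv1 labels) a ra (begin
    E2.label a     ≡⟨ sym (weight-marked₁ a ra) ⟩
    weight G f a   ≡⟨ q ⟩
    weight G f b   ≡⟨ cong (weight G f) (S1.R-nbr≡v a ra b ab) ⟩
    weight G f v   ≡⟨ weight-v ⟩
    1              ∎)
    where open ≡-Reasoning

  twin-cases : ∀ a b → Adj G a b → TrueOrFalse (S1.R a) → TrueOrFalse (S1.R b) →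
               Dec (a ≡ v) → Dec (b ≡ v) → Dec (a ≡ x) → Dec (b ≡ x) →
          weight G f a ≢ weight G f b
  twin-cases a b ab (inj₁ ra) _ _ _ _ _ = marked-twin a b ab ra
  twin-cases a b ab (inj₂ ra) (inj₁ rb) _ _ _ _ = marked-twin b a (Adj-sym G ab) rb ∘ sym
  twin-cases a b ab (inj₂ ra) (inj₂ rb) (yes refl) (yes refl) _ _ q = Adj-irrefl G ab
  twin-cases a b ab (inj₂ ra) (inj₂ rb) (yes refl) (no bv) _ _ q =
    1+n≢0 (trans (sym weight-v) (trans q (trans (cong (weight G f) (unmarked-nbr-v≡x b ab rb)) weight-x)))
  twin-cases a b ab (inj₂ ra) (inj₂ rb) (no av) (yes refl) _ _ q =
    1+n≢0 (trans (sym weight-v) (trans (sym q) (trans (cong (weight G f) (unmarked-nbr-v≡x a (Adj-sym G ab) ra)) weight-x)))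
  twin-cases a b ab (inj₂ ra) (inj₂ rb) (no av) (no bv) (yes refl) (yes refl) q = Adj-irrefl G ab
  twin-cases a b ab (inj₂ ra) (inj₂ rb) (no av) (no bv) (yes refl) (no bx) q =
    label-other≢0 b rb2 bv (trans (sym (weight-marked₂ b rb2 bv)) (trans (sym q) weight-x))
    where rb2 = all-marked₂ b (S1.Adj⇒Adj-pruned x b av ra ab)
  twin-cases a b ab (inj₂ ra) (inj₂ rb) (no av) (no bv) (no ax) (yes refl) q =
    label-other≢0 a ra2 av (trans (sym (weight-marked₂ a ra2 av)) (trans q weight-x))
    where ra2 = all-marked₂ a (S1.Adj⇒Adj-pruned x a bv rb (Adj-sym G ab))
  twin-cases a b ab (inj₂ ra) (inj₂ rb) (no av) (no bv) (no ax) (no bx) q =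
    TwinEdgeColouring.twin col₂ a b (S2.Adj⇒Adj-pruned a b ax ra2 ab1)
        (trans (sym (weight-unmarked a av ra ax ra2)) (trans q (weight-unmarked b bv rb bx rb2)))
    where
    ab1 = S1.Adj⇒Adj-pruned a b av ra ab
    ba1 = S1.Adj⇒Adj-pruned b a bv rb (Adj-sym G ab)
    ra2 = unmarked₂ a b ab1 bx
    rb2 = unmarked₂ b a ba1 ax

  twin : ∀ a b → Adj G a b → weight G f a ≢ weight G f b
  twin a b ab = twin-cases a b ab (true-or-false (S1.R a)) (true-or-false (S1.R b)) (a ≟F v) (b ≟F v) (a ≟F x) (b ≟F x)

  nbr-of-full-leaf : ∀ z → z ≢ v → z ≢ x → S1.R z ≡ false → S2.R z ≡ false → FullStarCentre G₂ z →
         ∀ y → Adj G z y → Dec (y ≡ v) → Dec (y ≡ x) → Leaf G y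
  nbr-of-full-leaf z zv zx rz rz2 ex y zy (yes refl) _ = ⊥-elim (zx (unmarked-nbr-v≡x z (Adj-sym G zy) rz))
  nbr-of-full-leaf z zv zx rz rz2 ex y zy (no yv) (yes refl) with
      trans (sym (all-marked₂ z (Adj-sym G₁ (S1.Adj⇒Adj-pruned z x zv rz zy)))) rz2
  ... | ()
  nbr-of-full-leaf z zv zx rz rz2 ex y zy (no yv) (no yx) =
    S1.Leaf-pruned⇒Leaf y yv R1y (S2.Leaf-pruned⇒Leaf y yx R2y (proj₂ ex y zy2))
    where
    R1y = S1.R-nbr-of-other z zv y zy
    zy1 = S1.Adj⇒Adj-pruned z y zv rz zy
    R2y = S2.R-nbr-of-other z zx y zy1
    zy2 = S2.Adj⇒Adj-pruned z y zx rz2 zy1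

  invariant-cases : ∀ u z → Adj G u z → Leaf G u → toℕ (f u z) ≡ 0 →
         TrueOrFalse (S1.R u) → Dec (u ≡ v) → TrueOrFalse (S1.R z) → Dec (u ≡ x) →
             TrueOrFalse (S2.R u) → TrueOrFalse (S2.R z) → Dec (z ≡ v) → Dec (z ≡ x) →
         FullStarCentre G z
  invariant-cases u z uz lu f0 (inj₁ ru) _ _ _ _ _ _ _ =
    ⊥-elim (All-Lv (DoubleStarLabels.Lvnz labels) u ru (trans (sym (E2.f-marked-v u ru))
        (trans (cong (λ w → toℕ (f u w)) (sym (S1.R-nbr≡v u ru z uz))) f0)))
  invariant-cases u z uz lu f0 (inj₂ ru) (yes refl) _ _ _ _ _ _ = ⊥-elim (c≢x (leaf-nbr-unique G lu vc vx))
  invariant-cases u z uz lu f0 (inj₂ ru) (no uv) (inj₁ rz) _ _ _ _ _ = ⊥-elim (uv (S1.R-nbr≡v z rz u (Adj-sym G uz)))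
  invariant-cases u z uz lu f0 (inj₂ ru) (no uv) (inj₂ rz) (yes refl) _ _ _ _ = ⊥-elim (¬x-leaf lu)
  invariant-cases u z uz lu f0 (inj₂ ru) (no uv) (inj₂ rz) (no ux) (inj₁ ru2) _ _ _ =
    ⊥-elim (label-other≢0 u ru2 uv (trans (sym (E1.f-marked-v u ru2))
        (trans (cong (λ w → toℕ (f₁ u w)) (sym (S2.R-nbr≡v u ru2 z (S1.Adj⇒Adj-pruned u z uv ru uz))))
      (trans (cong toℕ (sym (E2.f-unmarked u z ru rz))) f0))))
  invariant-cases u z uz lu f0 (inj₂ ru) (no uv) (inj₂ rz) (no ux) (inj₂ ru2) (inj₁ rz2) _ _ =
    ⊥-elim (ux (S2.R-nbr≡v z rz2 u (Adj-sym G₁ (S1.Adj⇒Adj-pruned u z uv ru uz))))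
  invariant-cases u z uz lu f0 (inj₂ ru) (no uv) (inj₂ rz) (no ux) (inj₂ ru2) (inj₂ rz2) (yes refl) _ =
    ⊥-elim (ux (unmarked-nbr-v≡x u (Adj-sym G uz) ru))
  invariant-cases u z uz lu f0 (inj₂ ru) (no uv) (inj₂ rz) (no ux) (inj₂ ru2) (inj₂ rz2) (no zv) (yes refl) =
    ⊥-elim (x-isolated₂ u (trans (Graph.sym G₂ x u) (S2.Adj⇒Adj-pruned u x ux ru2 (S1.Adj⇒Adj-pruned u x uv ru uz))))
  invariant-cases u z uz lu f0 (inj₂ ru) (no uv) (inj₂ rz) (no ux) (inj₂ ru2) (inj₂ rz2) (no zv) (no zx) =
    trans (sym (S1.deg-pruned-unmarked z zv rz)) (trans (sym (S2.deg-pruned-unmarked z zx rz2)) (proj₁ ex)) ,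
    λ y zy → nbr-of-full-leaf z zv zx rz rz2 ex y zy (y ≟F v) (y ≟F x)
    where
    uz1 = S1.Adj⇒Adj-pruned u z uv ru uz
    ex = invariant₂ u z (S2.Adj⇒Adj-pruned u z ux ru2 uz1) (S2.Leaf⇒Leaf-pruned u ux ru2 (S1.Leaf⇒Leaf-pruned u uv ru lu))
           (trans (cong toℕ (sym (E1.f-unmarked u z ru2 rz2))) (trans (cong toℕ (sym (E2.f-unmarked u z ru rz))) f0))

  invariant : ZeroLeafEdgesAtFullStars G f
  invariant u z uz lu f0 = invariant-cases u z uz lu f0 (true-or-false (S1.R u)) (u ≟F v) (true-or-false (S1.R z)) (u ≟F x)
      (true-or-false (S2.R u)) (true-or-false (S2.R z)) (z ≟F v) (z ≟F x)

  result : Good G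
  result = record { f = f ; symm = E2.symm (E1.symm (TwinEdgeColouring.symm col₂))
                  ; proper = E2.proper (E1.proper (TwinEdgeColouring.proper col₂) count≡length₂
                                          (nth-injective (Unique-insertAt r 0 T (All.map ≢-sym (DoubleStarLabels.Tnz labels))
                                              (DoubleStarLabels.Tdist labels))) avoid1)
                               count≡length₁ (nth-injective (DoubleStarLabels.Lvdist labels)) avoid2
                  ; twin = twin } , invariant
    where
    avoid1 : ∀ y → Adj G₂ x y → ∀ i → i < length Lx → toℕ (f₂ x y) ≢ nth Lx i
    avoid1 y a = ⊥-elim (x-isolated₂ y a)
    avoid2 : ∀ y → Adj G₁ v y → ∀ i → i < length Lv → toℕ (f₁ v y) ≢ nth Lv i
    avoid2 y a i lt q = All-nth (DoubleStarLabels.Lvnz labels) i lt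
        (trans (sym q) (trans (cong (λ w → toℕ (f₁ v w)) (only-x₁ y a)) f₁-vx))

module Induction (H : ℕ) where
  open Invariant H

  edgeless-good : ∀ {n} (G : Graph n) → (∀ a b → ¬ Adj G a b) → Good G
  edgeless-good G edgeless =
    record { f = λ _ _ → zero ; symm = λ a b ab → ⊥-elim (edgeless a b ab)
           ; proper = λ u a b ua → ⊥-elim (edgeless u a ua) ; twin = λ a b ab → ⊥-elim (edgeless a b ab) }
    , λ u z uz → ⊥-elim (edgeless u z uz)

  size : ∀ {n} → Graph n → ℕ
  size G = ΣFin (deg G)

  Adj⇒size-pos : ∀ {n} (G : Graph n) {a b} → Adj G a b → 1 ≤ size G
  Adj⇒size-pos G {a} {b} ab =
    ≤-trans (subst (_≤ deg G a) (ind-adj G a b ab) (f≤ΣFin (λ w → ind (adj G a w)) b)) (f≤ΣFin (deg G) a)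

  pruned-bounded : ∀ {n} (G : Graph n) v → Bounded G → Bounded (Prune.G' G v)
  pruned-bounded G v bounded u = ≤-trans (Prune.deg-pruned≤ G v u) (bounded u)

  good-colouring : ∀ N {n} (G : Graph n) → size G ≤ N → Forest G → NoIsolatedEdges G → Bounded G → Good G
  good-colouring N G _ _ _ _ with any? (λ a → any? (adj? G a))
  ... | no edgeless = edgeless-good G (λ a b ab → edgeless (a , b , ab))
  good-colouring zero G size≤0 _ _ _ | yes (_ , _ , ab) = ⊥-elim (<⇒≱ (Adj⇒size-pos G ab) size≤0)
  good-colouring (suc N) G size≤ forest noIso bounded | yes (_ , _ , ab) = by-cases (pendantStar G forest ab)
    where
    good-pruned : ∀ v c → Adj G v c → Leaf G c → Good (Prune.G' G v)
    good-pruned v c vc c-leaf = good-colouring N (Prune.G' G v)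
      (≤-pred (≤-trans (Prune.size-decreases G v c (Prune.pendant⇒R G v c vc c-leaf)) size≤))
      (Prune.pruned-forest G v forest) (Prune.pruned-noIsolatedEdges G v noIso) (pruned-bounded G v bounded)

    by-cases : PendantStar G → Good G
    by-cases (pendant-star v x c vc c-leaf leaves) with adj? G v x ×-dec ¬? (leaf? G x)
    ... | no x-not-inner = StarCase.result H G v c vc c-leaf all-leaves bounded noIso (good-pruned v c vc c-leaf)
      where
      all-leaves : ∀ y → Adj G v y → Leaf G y
      all-leaves y vy with y ≟F x
      ... | no y≢x = leaves y vy y≢x
      ... | yes refl with leaf? G y
      ...   | yes y-leaf = y-leaf
      ...   | no ¬y-leaf = ⊥-elim (x-not-inner (vy , ¬y-leaf))
    ... | yes (vx , ¬x-leaf) with deg G x ≟ D ×-dec all? (λ y → adj? G x y →-dec (¬? (y ≟F v) →-dec leaf? G y))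
    ...   | no x-unsaturated =
      PendantCase.result H G v x c vx ¬x-leaf vc c-leaf leaves bounded x-unsaturated (good-pruned v c vc c-leaf)
    ...   | yes (deg-x , x-leaves) with deg G v ≟ D
    ...     | no deg-v≢D =
      PendantCase.result H G x v c′ (Adj-sym G vx) ¬v-leaf xc′ c′-leaf x-leaves bounded (λ (deg-v , _) → deg-v≢D deg-v)
        (good-pruned x c′ xc′ c′-leaf)
      where
      ¬v-leaf : ¬ Leaf G v
      ¬v-leaf v-leaf = ¬x-leaf (subst (Leaf G) (leaf-nbr-unique G v-leaf vc vx) c-leaf)
      other = ¬Leaf⇒other-nbr G ¬x-leaf (Adj-sym G vx)
      c′ = proj₁ other
      xc′ = proj₁ (proj₂ other)
      c′-leaf = x-leaves c′ xc′ (proj₂ (proj₂ other))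
    ...     | yes deg-v = DoubleStarCase.result H G v x c vx vc c-leaf ¬x-leaf leaves x-leaves deg-v deg-x
      (good-colouring N G₂ size₂≤
        (S₂.pruned-forest (S₁.pruned-forest forest)) (S₂.pruned-noIsolatedEdges (S₁.pruned-noIsolatedEdges noIso))
        (pruned-bounded G₁ x (pruned-bounded G v bounded)))
      where
      module S₁ = Prune G v
      G₁ = S₁.G'
      module S₂ = Prune G₁ x
      G₂ = S₂.G'
      size₂≤ : size G₂ ≤ N
      size₂≤ = ≤-pred (≤-trans (s≤s (ΣFin-mono _ _ S₂.deg-pruned≤))
          (≤-trans (S₁.size-decreases c (S₁.pendant⇒R c vc c-leaf)) size≤))

twin-colouring : ∀ {n} (G : Graph n) → Forest G → NoIsolatedEdges G →
                 ∀ H → Δ G ≤ pred (H + H) → TwinEdgeColouring G (suc (H + H))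
twin-colouring G forest noIso H Δ≤ =
  proj₁ (Induction.good-colouring H _ G ≤-refl forest noIso (λ u → ≤-trans (deg≤Δ G u) Δ≤))

m≡m%2+[m/2]+[m/2] : ∀ m → m ≡ m % 2 + (m / 2 + m / 2)
m≡m%2+[m/2]+[m/2] m = trans (m≡m%n+[m/n]*n m 2) (cong (m % 2 +_) (solve 1 (λ q → q :* con 2 := q :+ q) refl (m / 2)))

-- With q = ⌊Δ/2⌋ and H = q + 1 the palette has 2q + 3 colours: Δ + 2 for odd Δ, Δ + 3 for even Δ.
theorem6 : ∀ {n} (G : Graph n) → Forest G → NoIsolatedEdges G →
    (Δ G % 2 ≡ 1 → χ't≤ G (Δ G + 2)) × (Δ G % 2 ≡ 0 → χ't≤ G (Δ G + 3))
theorem6 G forest noIso = bound 1 2 refl , bound 0 3 refl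
  where
  q = Δ G / 2
  colouring : TwinEdgeColouring G (suc (suc q + suc q))
  colouring = twin-colouring G forest noIso (suc q) (begin
    Δ G                 ≡⟨ m≡m%2+[m/2]+[m/2] (Δ G) ⟩
    Δ G % 2 + (q + q)   ≤⟨ +-monoˡ-≤ (q + q) (s≤s⁻¹ (m%n<n (Δ G) 2)) ⟩
    suc (q + q)         ≡⟨ sym (+-suc q q) ⟩
    q + suc q           ∎)
    where open ≤-Reasoning
  bound : ∀ r s → r + s ≡ 3 → Δ G % 2 ≡ r → χ't≤ G (Δ G + s)
  bound r s r+s≡3 Δ%2≡r = suc q + suc q , s≤s (s≤s z≤n) , ≤-reflexive palette , colouring
    where
    open ≡-Reasoning
    palette : suc (suc q + suc q) ≡ Δ G + s
    palette = begin
      suc (suc q + suc q)  ≡⟨ solve 1 (λ q → con 1 :+ ((con 1 :+ q) :+ (con 1 :+ q)) := (q :+ q) :+ con 3) refl q ⟩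
      (q + q) + 3          ≡⟨ cong (q + q +_) (sym r+s≡3) ⟩
      (q + q) + (r + s)    ≡⟨ solve 3 (λ qq r s → qq :+ (r :+ s) := (r :+ qq) :+ s) refl (q + q) r s ⟩
      (r + (q + q)) + s    ≡⟨ cong (λ r → r + (q + q) + s) (sym Δ%2≡r) ⟩
      (Δ G % 2 + (q + q)) + s ≡⟨ cong (_+ s) (sym (m≡m%2+[m/2]+[m/2] (Δ G))) ⟩
      Δ G + s              ∎
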